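{- Let $n\ge 3$, $m\ge n$, and $a=m-n+2\ge 2$. Let $\mathcal{T}(n,m;a,1,\dots,1)$ be the set of all weighted trees on $n$ vertices whose edge weights consist of one edge of weight $a$ and $n-2$ edges of weight $1$. Let $P_n^*$ be the weighted path on $n$ vertices in which one pendent edge has weight $a$ and all other edges have weight $1$. Then for every $T\in\mathcal{T}(n,m;a,1,\dots,1)$ with $T\neq P_n^*$ (as weighted graphs), $T\prec P_n^*$.
   Context: For a weighted bipartite graph $G$ of order $n$, $b_k(G)$ is the sum, over all matchings of $G$ with $k$ edges, of the product of the squares of the weights of the edges of the matching. For weighted bipartite graphs $G_1,G_2$ of order $n$, $G_1\preceq G_2$ means $b_k(G_1)\le b_k(G_2)$ for all $1\le k\le\lfloor n/2\rfloor$, and $G_1\prec G_2$ means $G_1\preceq G_2$ with $b_j(G_1)<b_j(G_2)$ for at least one $j$. A pendent edge is an edge incident to a vertex of degree $1$. -}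

module Defs where

open import Data.Nat using (ℕ; zero; suc; _+_; _*_; _∸_; _^_; _≤_; _<_; _/_)
import Data.Nat as N
open import Data.Fin as F using (Fin; toℕ; _≟_)
open import Data.List using (List; []; _∷_; _++_; map; filter; concatMap; allFin; length)
open import Data.Nat.ListAction using (sum; product)
open import Data.List.Relation.Unary.Unique.Propositional using (Unique)
import Data.List.Relation.Unary.Unique.DecPropositional as UD
open import Data.Product using (_×_; _,_; proj₁; proj₂; Σ; ∃; ∃-syntax)
open import Relation.Binary.PropositionalEquality using (_≡_; _≢_)
open import Relation.Nullary using (¬_; Dec; yes; no)
open import Relation.Nullary.Decidable using (_×-dec_; ¬?)
open import Data.Fin.Permutation using (Permutation′; _⟨$⟩ʳ_)
open import Data.Empty using (⊥)

-- A weighted graph on vertex set Fin n: symmetric, loopless weight function;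
-- w i j ≡ 0 means "no edge", w i j > 0 is the weight of edge {i,j}.
WGraph : ℕ → Set
WGraph n = Fin n → Fin n → ℕ

IsWGraph : ∀ {n} → WGraph n → Set
IsWGraph {n} w = (∀ i j → w i j ≡ w j i) × (∀ i → w i i ≡ 0)

Edge : ℕ → Set
Edge n = Fin n × Fin n

pairs : (n : ℕ) → List (Edge n)
pairs n = concatMap (λ i → map (λ j → (i , j)) (filter (λ j → i F.<? j) (allFin n))) (allFin n)

edges : ∀ {n} → WGraph n → List (Edge n)
edges w = filter (λ e → ¬? (w (proj₁ e) (proj₂ e) N.≟ 0)) (pairs _)

sublists : ∀ {A : Set} → List A → List (List A)
sublists [] = [] ∷ []
sublists (x ∷ xs) = sublists xs ++ map (x ∷_) (sublists xs)

endpoints : ∀ {n} → List (Edge n) → List (Fin n)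
endpoints = concatMap (λ e → proj₁ e ∷ proj₂ e ∷ [])

isKMatching? : ∀ {n} (k : ℕ) (S : List (Edge n)) → Dec ((length S ≡ k) × Unique (endpoints S))
isKMatching? k S = (length S N.≟ k) ×-dec UD.unique? _≟_ (endpoints S)

b : ∀ {n} → ℕ → WGraph n → ℕ
b k w = sum (map (λ S → product (map (λ e → w (proj₁ e) (proj₂ e) ^ 2) S))
                 (filter (isKMatching? k) (sublists (edges w))))

_⪯_ : ∀ {n} → WGraph n → WGraph n → Set
_⪯_ {n} G₁ G₂ = ∀ k → 1 ≤ k → k ≤ n / 2 → b k G₁ ≤ b k G₂

_≺_ : ∀ {n} → WGraph n → WGraph n → Set
_≺_ {n} G₁ G₂ = G₁ ⪯ G₂ × ∃[ j ] (1 ≤ j × j ≤ n / 2 × b j G₁ < b j G₂)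

Adj : ∀ {n} → WGraph n → Fin n → Fin n → Set
Adj w i j = w i j ≢ 0

data Walk {n} (w : WGraph n) : Fin n → Fin n → Set where
  here : ∀ {i} → Walk w i i
  step : ∀ {i j k} → Adj w i j → Walk w j k → Walk w i k

Connected : ∀ {n} → WGraph n → Set
Connected w = ∀ i j → Walk w i j

data CyclePath {n} (w : WGraph n) (first : Fin n) : List (Fin n) → Set where
  last : ∀ {v} → Adj w v first → CyclePath w first (v ∷ [])
  cons : ∀ {u v vs} → Adj w u v → CyclePath w first (v ∷ vs) → CyclePath w first (u ∷ v ∷ vs)

IsCycle : ∀ {n} → WGraph n → List (Fin n) → Set
IsCycle w [] = ⊥
IsCycle w (v ∷ vs) = (3 ≤ length (v ∷ vs)) × Unique (v ∷ vs) × CyclePath w v (v ∷ vs)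

Acyclic : ∀ {n} → WGraph n → Set
Acyclic {n} w = ∀ (c : List (Fin n)) → ¬ IsCycle w c

IsTree : ∀ {n} → WGraph n → Set
IsTree w = IsWGraph w × Connected w × Acyclic w

countWeight : ∀ {n} → ℕ → WGraph n → ℕ
countWeight c w = length (filter (λ e → w (proj₁ e) (proj₂ e) N.≟ c) (edges w))

InTreeClass : (n a : ℕ) → WGraph n → Set
InTreeClass n a w = IsTree w
                  × (∀ i j → w i j ≢ 0 → (w i j ≡ 1 Data.Sum.⊎ w i j ≡ a))
                  × countWeight a w ≡ 1
  where import Data.Sum

-- P_n^*: the path 0 - 1 - … - (n-1) whose pendent edge {0,1} has weight a, other edges weight 1
pathStar : (n a : ℕ) → WGraph n
pathStar n a i j with toℕ i | toℕ j
... | zero  | suc zero = a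
... | suc zero | zero  = a
... | x | y with suc x N.≟ y | suc y N.≟ x
...   | yes _ | _ = 1
...   | no _ | yes _ = 1
...   | no _ | no _ = 0

_≅_ : ∀ {n} → WGraph n → WGraph n → Set
_≅_ {n} G₁ G₂ = Σ (Permutation′ n) λ σ → ∀ i j → G₁ i j ≡ G₂ (σ ⟨$⟩ʳ i) (σ ⟨$⟩ʳ j)

-- Write m_k(G) for the number of k-matchings of the underlying graph of G and
-- let e = uv be the heavy edge.  Splitting matchings by whether they use e gives
--     b_{k+1}(G) + m_k(G - u - v) = m_{k+1}(G) + a² m_k(G - u - v).
-- Every forest on N vertices satisfies m_k ≤ p(N,k), the k-matching count of the
-- path on N vertices, by induction that deletes a leaf edge fg:
--     m_{k+1}(F) = m_{k+1}(F - f) + m_k(F - f - g),  the path recurrence for p.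
-- Since T - u - v is a forest on n - 2 vertices while P* meets both bounds with
-- equality, b_k(T) ≤ b_k(P*) for all k.  If no inequality is strict then, since
-- a² ≥ 2, both counts of T are extremal; the same leaf induction shows that a forest
-- with m_k = p(N,k) for all k is an induced Hamiltonian path, and counting the
-- edges of T - u - v shows that e is pendent, so T ≅ P*.
module Submission where

open import Defs
open import Data.Nat using (ℕ; _≤_; _∸_; _+_)
open import Relation.Nullary using (¬_)

module ListFacts where

  open import Data.Nat using (ℕ; suc; _+_; _*_; _≤_; z≤n; s≤s)
  open import Data.Nat.Properties using (+-suc; *-zeroʳ; *-distribˡ-+)
  open import Data.Nat.ListAction using (sum)
  open import Data.List using (List; []; _∷_; _++_; length; map; filter)
  open import Data.List.Properties using (length-++)
  open import Data.List.Relation.Unary.Any using (here; there)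
  open import Data.List.Membership.Propositional using (_∈_; _∉_)
  open import Data.List.Membership.Propositional.Properties using (∈-∃++)
  open import Data.List.Relation.Unary.Unique.Propositional using (Unique)
  open import Data.List.Relation.Unary.AllPairs using ([]; _∷_)
  open import Data.List.Relation.Unary.All using (_∷_)
  import Data.List.Relation.Unary.All as All
  import Data.List.Relation.Unary.All.Properties as AllP
  open import Data.Product using (Σ; _,_)
  open import Data.Empty using (⊥-elim)
  open import Relation.Nullary using (yes; no)
  open import Relation.Unary using (Decidable; Pred)
  open import Relation.Binary.PropositionalEquality
  open import Function using (_∘_)
  open import Level using (0ℓ)

  module _ {A : Set} where

    ∉-∷ : ∀ {v a : A} {xs} → v ≢ a → v ∉ xs → v ∉ a ∷ xs
    ∉-∷ v≢a v∉xs (here v≡a) = v≢a v≡a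
    ∉-∷ v≢a v∉xs (there v∈xs) = v∉xs v∈xs

    ∈-delete : ∀ {y x : A} pre post → y ∈ pre ++ x ∷ post → y ≢ x → y ∈ pre ++ post
    ∈-delete [] post (here y≡x) y≢x = ⊥-elim (y≢x y≡x)
    ∈-delete [] post (there m) _ = m
    ∈-delete (z ∷ pre) post (here y≡z) _ = here y≡z
    ∈-delete (z ∷ pre) post (there m) y≢x = there (∈-delete pre post m y≢x)

    unique-length-≤ : ∀ {xs ys : List A} → Unique xs → (∀ {x} → x ∈ xs → x ∈ ys) → length xs ≤ length ys
    unique-length-≤ {[]} _ _ = z≤n
    unique-length-≤ {x ∷ xs} (px ∷ u) xs⊆ys with ∈-∃++ (xs⊆ys (here refl))
    ... | pre , post , refl = subst (suc (length xs) ≤_) (sym length-split)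
          (s≤s (unique-length-≤ u (λ m → ∈-delete pre post (xs⊆ys (there m)) (≢-sym (All.lookup px m)))))
      where
      length-split : length (pre ++ x ∷ post) ≡ suc (length (pre ++ post))
      length-split = trans (length-++ pre) (trans (+-suc (length pre) (length post)) (cong suc (sym (length-++ pre))))

    unique-prefix : ∀ (xs : List A) {ys} → Unique (xs ++ ys) → Unique xs
    unique-prefix [] _ = []
    unique-prefix (x ∷ xs) (px ∷ u) = AllP.++⁻ˡ xs px ∷ unique-prefix xs u

    unique-head : ∀ {x : A} {xs} → Unique (x ∷ xs) → x ∉ xs
    unique-head (px ∷ _) = AllP.All¬⇒¬Any px

    unique-swap : ∀ {x y : A} {zs} → Unique (x ∷ y ∷ zs) → Unique (y ∷ x ∷ zs)
    unique-swap ((x≢y ∷ px) ∷ (py ∷ u)) = (≢-sym x≢y ∷ py) ∷ (px ∷ u)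

    unique-move : ∀ (x : A) xs ys → Unique (x ∷ xs ++ ys) → Unique (xs ++ x ∷ ys)
    unique-move x [] ys u = u
    unique-move x (z ∷ xs) ys ((x≢z ∷ px) ∷ (pz ∷ u)) =
      AllP.++⁺ (AllP.++⁻ˡ xs pz) (≢-sym x≢z ∷ AllP.++⁻ʳ xs pz) ∷ unique-move x xs ys (px ∷ u)

    unique-move⁻ : ∀ (x : A) xs ys → Unique (xs ++ x ∷ ys) → Unique (x ∷ xs ++ ys)
    unique-move⁻ x [] ys u = u
    unique-move⁻ x (z ∷ xs) ys (pz ∷ u') with unique-move⁻ x xs ys u'
    ... | px ∷ u = (x≢z ∷ px) ∷ (AllP.++⁺ (AllP.++⁻ˡ xs pz) (All.tail (AllP.++⁻ʳ xs pz)) ∷ u)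
      where
      x≢z : x ≢ z
      x≢z = ≢-sym (All.head (AllP.++⁻ʳ xs pz))

    length≡1⇒singleton : ∀ (xs : List A) → length xs ≡ 1 → Σ A λ x → xs ≡ x ∷ []
    length≡1⇒singleton (x ∷ []) _ = x , refl

  filter-map : ∀ {A B : Set} {P : Pred B 0ℓ} (P? : Decidable P) (f : A → B) xs →
    filter P? (map f xs) ≡ map f (filter (P? ∘ f) xs)
  filter-map P? f [] = refl
  filter-map P? f (x ∷ xs) with P? (f x)
  ... | yes _ = cong (f x ∷_) (filter-map P? f xs)
  ... | no _ = filter-map P? f xs

  sum-scale : ∀ {A : Set} (c : ℕ) (g : A → ℕ) xs → sum (map (λ S → c * g S) xs) ≡ c * sum (map g xs)
  sum-scale c g [] = sym (*-zeroʳ c)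
  sum-scale c g (x ∷ xs) = trans (cong (c * g x +_) (sum-scale c g xs)) (sym (*-distribˡ-+ c (g x) _))


-- For an edge list E (no repetitions), a list X of vertices already covered
-- and a weight wt on edges, ν wt k E X is the sum over the k-edge matchings S
-- inside E that avoid X of the product of the weights wt e (e ∈ S).
module Matchings where

  open import Data.Nat using (ℕ; zero; suc; _+_; _*_; _≤_)
  open import Data.Nat.Properties
  open import Data.Fin as F using (Fin)
  open import Data.List using (List; []; _∷_)
  open import Data.List.Relation.Unary.Any using (here; there)
  open import Data.List.Membership.Propositional using (_∈_; _∉_)
  open import Data.List.Relation.Unary.Unique.Propositional using (Unique)
  open import Data.List.Relation.Unary.AllPairs using ([]; _∷_)
  open import Data.List.Relation.Unary.All using (All; []; _∷_)
  open import Data.List.Relation.Unary.All.Properties using (All¬⇒¬Any)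
  open import Data.Product using (_×_; _,_; proj₁; proj₂; Σ)
  open import Data.Sum using (_⊎_; inj₁; inj₂)
  open import Data.Empty using (⊥-elim)
  open import Relation.Nullary using (¬_; Dec; yes; no)
  open import Relation.Nullary.Decidable using (_×-dec_; ¬?)
  open import Relation.Binary.PropositionalEquality
  import Data.Product.Properties as PP
  open import Algebra.Properties.CommutativeSemigroup +-commutativeSemigroup
    using (xy∙z≈xz∙y; interchange)
  open import Algebra.Properties.CommutativeSemigroup *-commutativeSemigroup
    using (x∙yz≈y∙xz)
  open import Function using (_∘_)
  open import Defs using (Edge)
  open ListFacts using (∉-∷)

  onlyIf : ∀ {A : Set} → Dec A → ℕ → ℕ
  onlyIf (yes _) x = x
  onlyIf (no _) x = 0

  onlyIf-yes : ∀ {A : Set} (d : Dec A) {x} → A → onlyIf d x ≡ x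
  onlyIf-yes (yes _) a = refl
  onlyIf-yes (no ¬a) a = ⊥-elim (¬a a)

  onlyIf-no : ∀ {A : Set} (d : Dec A) {x} → ¬ A → onlyIf d x ≡ 0
  onlyIf-no (yes a) ¬a = ⊥-elim (¬a a)
  onlyIf-no (no _) ¬a = refl

  onlyIf-cong : ∀ {A B : Set} (d : Dec A) (d' : Dec B) {x y} → (A → B) → (B → A) → x ≡ y → onlyIf d x ≡ onlyIf d' y
  onlyIf-cong (yes a) (yes b) f g e = e
  onlyIf-cong (yes a) (no ¬b) f g e = ⊥-elim (¬b (f a))
  onlyIf-cong (no ¬a) (yes b) f g e = ⊥-elim (¬a (g b))
  onlyIf-cong (no _) (no _) f g e = refl

  onlyIf-distrib : ∀ {A : Set} (D : Dec A) w x y → onlyIf D (w * (x + y)) ≡ onlyIf D (w * x) + onlyIf D (w * y)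
  onlyIf-distrib (yes _) w x y = *-distribˡ-+ w x y
  onlyIf-distrib (no _) w x y = refl

  -- Every edge has weight 1: ν unitWeight counts matchings of the underlying graph.
  unitWeight : ∀ {A : Set} → A → ℕ
  unitWeight _ = 1

  module Counting (n : ℕ) where
    open import Data.List.Membership.DecPropositional (F._≟_ {n}) using (_∈?_) public

    V : Set
    V = Fin n
    Ed : Set
    Ed = Edge n

    Avoid : Ed → List V → Set
    Avoid e X = proj₁ e ∉ X × proj₂ e ∉ X

    avoid? : (e : Ed) (X : List V) → Dec (Avoid e X)
    avoid? e X = ¬? (proj₁ e ∈? X) ×-dec ¬? (proj₂ e ∈? X)

    cover : Ed → List V → List V
    cover e X = proj₁ e ∷ proj₂ e ∷ X

    ν : (Ed → ℕ) → ℕ → List Ed → List V → ℕ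
    ν wt zero E X = 1
    ν wt (suc k) [] X = 0
    ν wt (suc k) (e ∷ E) X = ν wt (suc k) E X + onlyIf (avoid? e X) (wt e * ν wt k E (cover e X))

    _⊆_ : List V → List V → Set
    X ⊆ Y = ∀ {v} → v ∈ X → v ∈ Y

    -- ν only depends on X as a set.
    SameSet : List V → List V → Set
    SameSet X Y = X ⊆ Y × Y ⊆ X

    ⊆-∷ : ∀ {a X Y} → X ⊆ Y → (a ∷ X) ⊆ (a ∷ Y)
    ⊆-∷ s (here p) = here p
    ⊆-∷ s (there p) = there (s p)

    ss-refl : ∀ {X} → SameSet X X
    ss-refl = (λ z → z) , (λ z → z)

    ss-trans : ∀ {X Y Z} → SameSet X Y → SameSet Y Z → SameSet X Z
    ss-trans (a , b) (c , d) = (c ∘ a) , (b ∘ d)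

    ss-∷ : ∀ {a X Y} → SameSet X Y → SameSet (a ∷ X) (a ∷ Y)
    ss-∷ (s , t) = ⊆-∷ s , ⊆-∷ t

    ss-cover : ∀ {e X Y} → SameSet X Y → SameSet (cover e X) (cover e Y)
    ss-cover s = ss-∷ (ss-∷ s)

    swap-front : ∀ {a b X} → SameSet (a ∷ b ∷ X) (b ∷ a ∷ X)
    swap-front = f , f
      where
      f : ∀ {a b X} → (a ∷ b ∷ X) ⊆ (b ∷ a ∷ X)
      f (here p) = there (here p)
      f (there (here p)) = here p
      f (there (there p)) = there (there p)

    cover-cover-swap : ∀ d e X → SameSet (cover d (cover e X)) (cover e (cover d X))
    cover-cover-swap d e X = f , f
      where
      f : ∀ {a b c d Y} → (a ∷ b ∷ c ∷ d ∷ Y) ⊆ (c ∷ d ∷ a ∷ b ∷ Y)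
      f (here p) = there (there (here p))
      f (there (here p)) = there (there (there (here p)))
      f (there (there (here p))) = here p
      f (there (there (there (here p)))) = there (here p)
      f (there (there (there (there p)))) = there (there (there (there p)))

    avoid-⊆ : ∀ {e X Y} → Y ⊆ X → Avoid e X → Avoid e Y
    avoid-⊆ s (a , b) = (a ∘ s) , (b ∘ s)

    avoid-cover⇒ : ∀ {e d X} → Avoid e (cover d X) → Avoid e X
    avoid-cover⇒ = avoid-⊆ (there ∘ there)

    avoid-sym : ∀ {e d X} → Avoid d X → Avoid e (cover d X) → Avoid d (cover e X)
    avoid-sym (a , b) (c , d') =
      ∉-cover a (c ∘ here ∘ sym) (d' ∘ here ∘ sym) , ∉-cover b (c ∘ there ∘ here ∘ sym) (d' ∘ there ∘ here ∘ sym)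
      where
      ∉-cover : ∀ {v e X} → v ∉ X → v ≢ proj₁ e → v ≢ proj₂ e → v ∉ cover e X
      ∉-cover v∉X ne₁ ne₂ = ∉-∷ ne₁ (∉-∷ ne₂ v∉X)

    ν-cong-used : ∀ wt k E {X Y} → SameSet X Y → ν wt k E X ≡ ν wt k E Y
    ν-cong-used wt zero E s = refl
    ν-cong-used wt (suc k) [] s = refl
    ν-cong-used wt (suc k) (e ∷ E) {X} {Y} s = cong₂ _+_ (ν-cong-used wt (suc k) E s)
      (onlyIf-cong (avoid? e X) (avoid? e Y) (avoid-⊆ (proj₂ s)) (avoid-⊆ (proj₁ s))
        (cong (wt e *_) (ν-cong-used wt k E (ss-cover s))))

    ν-cong-weight : ∀ wt wt' k E X → (∀ {d} → d ∈ E → wt d ≡ wt' d) → ν wt k E X ≡ ν wt' k E X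
    ν-cong-weight wt wt' zero E X h = refl
    ν-cong-weight wt wt' (suc k) [] X h = refl
    ν-cong-weight wt wt' (suc k) (d ∷ E) X h = cong₂ _+_ (ν-cong-weight wt wt' (suc k) E X (h ∘ there))
      (cong (onlyIf (avoid? d X)) (cong₂ _*_ (h (here refl)) (ν-cong-weight wt wt' k E (cover d X) (h ∘ there))))

    ν-no-free-edge : ∀ wt k E X → (∀ {d} → d ∈ E → ¬ Avoid d X) → ν wt (suc k) E X ≡ 0
    ν-no-free-edge wt k [] X h = refl
    ν-no-free-edge wt k (d ∷ E) X h =
      cong₂ _+_ (ν-no-free-edge wt k E X (h ∘ there)) (onlyIf-no (avoid? d X) (h (here refl)))

    _≟E_ : (d e : Ed) → Dec (d ≡ e)
    _≟E_ = PP.≡-dec F._≟_ F._≟_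

    remove : Ed → List Ed → List Ed
    remove e [] = []
    remove e (d ∷ E) with d ≟E e
    ... | yes _ = remove e E
    ... | no _ = d ∷ remove e E

    remove-∉ : ∀ e E → e ∉ E → remove e E ≡ E
    remove-∉ e [] _ = refl
    remove-∉ e (d ∷ E) ni with d ≟E e
    ... | yes refl = ⊥-elim (ni (here refl))
    ... | no _ = cong (d ∷_) (remove-∉ e E (ni ∘ there))

    remove-∈⁻ : ∀ {d e E} → d ∈ remove e E → d ∈ E × d ≢ e
    remove-∈⁻ {d} {e} {x ∷ E} m with x ≟E e
    ... | yes _ = let (a , b) = remove-∈⁻ {E = E} m in there a , b
    remove-∈⁻ {d} {e} {x ∷ E} (here refl) | no ne = here refl , ne
    remove-∈⁻ {d} {e} {x ∷ E} (there m) | no ne = let (a , b) = remove-∈⁻ {E = E} m in there a , b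

    remove-∈⁺ : ∀ {d e E} → d ∈ E → d ≢ e → d ∈ remove e E
    remove-∈⁺ {d} {e} {x ∷ E} m ne with x ≟E e
    remove-∈⁺ {d} {e} {x ∷ E} (here refl) ne | yes p = ⊥-elim (ne p)
    remove-∈⁺ {d} {e} {x ∷ E} (there m) ne | yes p = remove-∈⁺ m ne
    remove-∈⁺ {d} {e} {x ∷ E} (here refl) ne | no _ = here refl
    remove-∈⁺ {d} {e} {x ∷ E} (there m) ne | no _ = there (remove-∈⁺ m ne)

    remove-unique : ∀ e {E} → Unique E → Unique (remove e E)
    remove-unique e {[]} u = []
    remove-unique e {x ∷ E} (px ∷ u) with x ≟E e
    ... | yes _ = remove-unique e u
    ... | no _ = all-remove px ∷ remove-unique e u
      where
      all-remove : ∀ {E'} → All (x ≢_) E' → All (x ≢_) (remove e E')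
      all-remove {[]} [] = []
      all-remove {y ∷ E'} (p ∷ ps) with y ≟E e
      ... | yes _ = all-remove ps
      ... | no _ = p ∷ all-remove ps

    -- An edge that is not free never contributes, so it may be deleted.
    ν-remove-blocked : ∀ wt k E e X → ¬ Avoid e X → ν wt k E X ≡ ν wt k (remove e E) X
    ν-remove-blocked wt zero E e X t = refl
    ν-remove-blocked wt (suc k) [] e X t = refl
    ν-remove-blocked wt (suc k) (d ∷ E) e X t with d ≟E e
    ... | yes refl = trans (cong₂ _+_ refl (onlyIf-no (avoid? d X) t))
                       (trans (+-identityʳ _) (ν-remove-blocked wt (suc k) E e X t))
    ... | no _ = cong₂ _+_ (ν-remove-blocked wt (suc k) E e X t)
                   (cong (onlyIf (avoid? d X)) (cong (wt d *_)
                     (ν-remove-blocked wt k E e (cover d X) (t ∘ avoid-⊆ (there ∘ there)))))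

    choose-two-commute : ∀ (wt : Ed → ℕ) d e X B B' → B ≡ B' →
      onlyIf (avoid? d X) (wt d * onlyIf (avoid? e (cover d X)) (wt e * B))
        ≡ onlyIf (avoid? e X) (wt e * onlyIf (avoid? d (cover e X)) (wt d * B'))
    choose-two-commute wt d e X B .B refl with avoid? d X | avoid? e X | avoid? e (cover d X) | avoid? d (cover e X)
    ... | yes _ | yes _ | yes _ | yes _ = x∙yz≈y∙xz (wt d) (wt e) B
    ... | yes ad | yes ae | yes aed | no nde = ⊥-elim (nde (avoid-sym ad aed))
    ... | yes _ | yes ae | no ned | yes ade = ⊥-elim (ned (avoid-sym ae ade))
    ... | yes _ | yes _ | no _ | no _ = trans (*-zeroʳ (wt d)) (sym (*-zeroʳ (wt e)))
    ... | yes _ | no ne | yes aed | _ = ⊥-elim (ne (avoid-cover⇒ aed))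
    ... | yes _ | no _ | no _ | _ = *-zeroʳ (wt d)
    ... | no nd | yes _ | _ | yes ade = ⊥-elim (nd (avoid-cover⇒ ade))
    ... | no _ | yes _ | _ | no _ = sym (*-zeroʳ (wt e))
    ... | no _ | no _ | _ | _ = refl

    ν-extract : ∀ wt k E e X → Unique E → e ∈ E →
      ν wt (suc k) E X ≡ ν wt (suc k) (remove e E) X + onlyIf (avoid? e X) (wt e * ν wt k (remove e E) (cover e X))
    ν-extract wt k (d ∷ E) e X (px ∷ uE) mem with d ≟E e
    ... | yes refl rewrite remove-∉ d E (All¬⇒¬Any px) = refl
    ... | no d≢e = extract-later k
      where
      e∈E : e ∈ E
      e∈E = later mem
        where
        later : e ∈ d ∷ E → e ∈ E
        later (here e≡d) = ⊥-elim (d≢e (sym e≡d))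
        later (there m) = m
      R : List Ed
      R = remove e E
      extract-later : ∀ k → ν wt (suc k) E X + onlyIf (avoid? d X) (wt d * ν wt k E (cover d X))
                 ≡ (ν wt (suc k) R X + onlyIf (avoid? d X) (wt d * ν wt k R (cover d X)))
                     + onlyIf (avoid? e X) (wt e * ν wt k (d ∷ R) (cover e X))
      extract-later zero = trans (cong (_+ onlyIf (avoid? d X) (wt d * 1)) (ν-extract wt 0 E e X uE e∈E))
                        (xy∙z≈xz∙y (ν wt 1 R X) _ _)
      extract-later (suc k') = begin
          ν wt (suc (suc k')) E X + onlyIf (avoid? d X) (wt d * ν wt (suc k') E (cover d X))
            ≡⟨ cong₂ _+_ (ν-extract wt (suc k') E e X uE e∈E)
                         (cong (λ z → onlyIf (avoid? d X) (wt d * z)) (ν-extract wt k' E e (cover d X) uE e∈E)) ⟩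
          (A + onlyIf (avoid? e X) (wt e * C)) + onlyIf (avoid? d X) (wt d * (A₂ + onlyIf (avoid? e (cover d X)) (wt e * B)))
            ≡⟨ cong ((A + onlyIf (avoid? e X) (wt e * C)) +_) (onlyIf-distrib (avoid? d X) (wt d) A₂ _) ⟩
          (A + onlyIf (avoid? e X) (wt e * C)) + (onlyIf (avoid? d X) (wt d * A₂) + onlyIf (avoid? d X) (wt d * onlyIf (avoid? e (cover d X)) (wt e * B)))
            ≡⟨ interchange A _ _ _ ⟩
          (A + onlyIf (avoid? d X) (wt d * A₂)) + (onlyIf (avoid? e X) (wt e * C) + onlyIf (avoid? d X) (wt d * onlyIf (avoid? e (cover d X)) (wt e * B)))
            ≡⟨ cong (λ z → (A + onlyIf (avoid? d X) (wt d * A₂)) + (onlyIf (avoid? e X) (wt e * C) + z))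
                    (choose-two-commute wt d e X B B' (ν-cong-used wt k' R (cover-cover-swap e d X))) ⟩
          (A + onlyIf (avoid? d X) (wt d * A₂)) + (onlyIf (avoid? e X) (wt e * C) + onlyIf (avoid? e X) (wt e * onlyIf (avoid? d (cover e X)) (wt d * B')))
            ≡⟨ cong ((A + onlyIf (avoid? d X) (wt d * A₂)) +_) (sym (onlyIf-distrib (avoid? e X) (wt e) C _)) ⟩
          (A + onlyIf (avoid? d X) (wt d * A₂)) + onlyIf (avoid? e X) (wt e * (C + onlyIf (avoid? d (cover e X)) (wt d * B')))
          ∎
        where
        open ≡-Reasoning
        A : ℕ
        A = ν wt (suc (suc k')) R X
        C : ℕ
        C = ν wt (suc k') R (cover e X)
        A₂ : ℕ
        A₂ = ν wt (suc k') R (cover d X)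
        B : ℕ
        B = ν wt k' R (cover e (cover d X))
        B' : ℕ
        B' = ν wt k' R (cover d (cover e X))

    TouchV : V → Ed → Set
    TouchV f d = f ≡ proj₁ d ⊎ f ≡ proj₂ d

    touch? : (g : V) (d : Ed) → Dec (TouchV g d)
    touch? g d with g F.≟ proj₁ d | g F.≟ proj₂ d
    ... | yes a | _ = yes (inj₁ a)
    ... | no _ | yes b = yes (inj₂ b)
    ... | no a | no b = no λ { (inj₁ x) → a x ; (inj₂ y) → b y }

    Isolated : List Ed → V → List V → Set
    Isolated E f X = ∀ {d} → d ∈ E → TouchV f d → ¬ Avoid d X

    isolated-mono : ∀ {E f X Y} → X ⊆ Y → Isolated E f X → Isolated E f Y
    isolated-mono s i m t a = i m t (avoid-⊆ s a)

    ν-isolated : ∀ wt k E f X → Isolated E f X → ν wt k E (f ∷ X) ≡ ν wt k E X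
    ν-isolated wt zero E f X i = refl
    ν-isolated wt (suc k) [] f X i = refl
    ν-isolated wt (suc k) (d ∷ E) f X i = cong₂ _+_ (ν-isolated wt (suc k) E f X (i ∘ there))
       (onlyIf-cong (avoid? d (f ∷ X)) (avoid? d X) (avoid-⊆ there) free-without-f
         (cong (wt d *_) (trans (ν-cong-used wt k E reorder)
                                (ν-isolated wt k E f (cover d X) (isolated-mono (there ∘ there) (i ∘ there))))))
      where
      free-without-f : Avoid d X → Avoid d (f ∷ X)
      free-without-f (a , b) = ∉-∷ (λ p → i (here refl) (inj₁ (sym p)) (a , b)) a
                             , ∉-∷ (λ p → i (here refl) (inj₂ (sym p)) (a , b)) b
      reorder : SameSet (cover d (f ∷ X)) (f ∷ cover d X)
      reorder = ss-trans (ss-∷ swap-front) swap-front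

    Ends : Ed → V → V → Set
    Ends e f g = (proj₁ e ≡ f × proj₂ e ≡ g) ⊎ (proj₁ e ≡ g × proj₂ e ≡ f)

    ends-cover : ∀ {e f g X} → Ends e f g → SameSet (cover e X) (f ∷ g ∷ X)
    ends-cover (inj₁ (refl , refl)) = ss-refl
    ends-cover (inj₂ (refl , refl)) = swap-front

    ends-avoid⁺ : ∀ {e f g X} → Ends e f g → f ∉ X → g ∉ X → Avoid e X
    ends-avoid⁺ (inj₁ (refl , refl)) a b = a , b
    ends-avoid⁺ (inj₂ (refl , refl)) a b = b , a

    ends-avoid⁻ : ∀ {d f h X} → Ends d f h → Avoid d X → f ∉ X × h ∉ X
    ends-avoid⁻ (inj₁ (refl , refl)) (a , b) = a , b
    ends-avoid⁻ (inj₂ (refl , refl)) (a , b) = b , a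

    ends-blocked : ∀ {e f g Y} → Ends e f g → ¬ Avoid e (f ∷ Y)
    ends-blocked (inj₁ (refl , refl)) (a , b) = a (here refl)
    ends-blocked (inj₂ (refl , refl)) (a , b) = b (here refl)

    ends-touch : ∀ {d f g} → Ends d f g → TouchV f d
    ends-touch (inj₁ (refl , refl)) = inj₁ refl
    ends-touch (inj₂ (refl , refl)) = inj₂ refl

    touch-other : ∀ {f d} → TouchV f d → Σ V λ h → Ends d f h
    touch-other {f} {d} (inj₁ refl) = proj₂ d , inj₁ (refl , refl)
    touch-other {f} {d} (inj₂ refl) = proj₁ d , inj₂ (refl , refl)

    ends-same : ∀ {d f a b} → Ends d f a → Ends d f b → a ≡ b
    ends-same (inj₁ (a1 , a2)) (inj₁ (b1 , b2)) = trans (sym a2) b2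
    ends-same (inj₁ (a1 , a2)) (inj₂ (b1 , b2)) = trans (sym a2) (trans b2 (trans (sym a1) b1))
    ends-same (inj₂ (a1 , a2)) (inj₁ (b1 , b2)) = trans (sym a1) (trans b1 (trans (sym a2) b2))
    ends-same (inj₂ (a1 , a2)) (inj₂ (b1 , b2)) = trans (sym a1) b1

    leaf-split : ∀ wt k E e f g X → Unique E → e ∈ E → Ends e f g → f ∉ X → g ∉ X →
      (∀ {d} → d ∈ E → TouchV f d → d ≢ e → ¬ Avoid d X) →
      ν wt (suc k) E X ≡ ν wt (suc k) E (f ∷ X) + wt e * ν wt k E (f ∷ g ∷ X)
    leaf-split wt k E e f g X uE eE en fX gX only-e = begin
        ν wt (suc k) E X
          ≡⟨ ν-extract wt k E e X uE eE ⟩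
        ν wt (suc k) R X + onlyIf (avoid? e X) (wt e * ν wt k R (cover e X))
          ≡⟨ cong₂ _+_ (sym (ν-isolated wt (suc k) R f X f-isolated)) (onlyIf-yes (avoid? e X) (ends-avoid⁺ en fX gX)) ⟩
        ν wt (suc k) R (f ∷ X) + wt e * ν wt k R (cover e X)
          ≡⟨ cong₂ _+_ (sym (ν-remove-blocked wt (suc k) E e (f ∷ X) (ends-blocked en)))
                       (cong (wt e *_) (trans (ν-cong-used wt k R (ends-cover en))
                                              (sym (ν-remove-blocked wt k E e (f ∷ g ∷ X) (ends-blocked en))))) ⟩
        ν wt (suc k) E (f ∷ X) + wt e * ν wt k E (f ∷ g ∷ X)
        ∎
      where
      open ≡-Reasoning
      R : List Ed
      R = remove e E
      f-isolated : Isolated R f X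
      f-isolated m t = let (a , b) = remove-∈⁻ m in only-e a t b

    incident : V → List Ed → List Ed
    incident g [] = []
    incident g (d ∷ E) with touch? g d
    ... | yes _ = d ∷ incident g E
    ... | no _ = incident g E

    incident-∈ : ∀ {g d E} → d ∈ E → TouchV g d → d ∈ incident g E
    incident-∈ {g} {d} {x ∷ E} m t with touch? g x
    incident-∈ {g} {d} {x ∷ E} (here refl) t | yes _ = here refl
    incident-∈ {g} {d} {x ∷ E} (there m) t | yes _ = there (incident-∈ m t)
    incident-∈ {g} {d} {x ∷ E} (here refl) t | no nt = ⊥-elim (nt t)
    incident-∈ {g} {d} {x ∷ E} (there m) t | no nt = incident-∈ m t

    incident-unique : ∀ g {E} → Unique E → Unique (incident g E)
    incident-unique g {[]} u = []
    incident-unique g {x ∷ E} (px ∷ u) with touch? g x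
    ... | yes _ = all-incident px ∷ incident-unique g u
      where
      all-incident : ∀ {E'} → All (x ≢_) E' → All (x ≢_) (incident g E')
      all-incident {[]} [] = []
      all-incident {y ∷ E'} (q ∷ qs) with touch? g y
      ... | yes _ = q ∷ all-incident qs
      ... | no _ = all-incident qs
    ... | no _ = incident-unique g u

    ν1-split-at : ∀ E X g → ν unitWeight 1 E X ≡ ν unitWeight 1 E (g ∷ X) + ν unitWeight 1 (incident g E) X
    ν1-split-at [] X g = refl
    ν1-split-at (d ∷ E) X g with touch? g d
    ... | yes t = begin
        ν unitWeight 1 E X + onlyIf (avoid? d X) 1
          ≡⟨ cong (_+ onlyIf (avoid? d X) 1) (ν1-split-at E X g) ⟩
        (ν unitWeight 1 E (g ∷ X) + ν unitWeight 1 (incident g E) X) + onlyIf (avoid? d X) 1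
          ≡⟨ +-assoc (ν unitWeight 1 E (g ∷ X)) _ _ ⟩
        ν unitWeight 1 E (g ∷ X) + (ν unitWeight 1 (incident g E) X + onlyIf (avoid? d X) 1)
          ≡⟨ cong (_+ (ν unitWeight 1 (incident g E) X + onlyIf (avoid? d X) 1)) (sym (+-identityʳ (ν unitWeight 1 E (g ∷ X)))) ⟩
        (ν unitWeight 1 E (g ∷ X) + 0) + (ν unitWeight 1 (incident g E) X + onlyIf (avoid? d X) 1)
          ≡⟨ cong (λ z → (ν unitWeight 1 E (g ∷ X) + z) + (ν unitWeight 1 (incident g E) X + onlyIf (avoid? d X) 1))
                  (sym (onlyIf-no (avoid? d (g ∷ X)) {1} blocked)) ⟩
        (ν unitWeight 1 E (g ∷ X) + onlyIf (avoid? d (g ∷ X)) 1) + (ν unitWeight 1 (incident g E) X + onlyIf (avoid? d X) 1)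
        ∎
      where
      open ≡-Reasoning
      blocked : ¬ Avoid d (g ∷ X)
      blocked = ends-blocked (proj₂ (touch-other t))
    ... | no nt = trans (cong (_+ onlyIf (avoid? d X) 1) (ν1-split-at E X g))
                   (trans (xy∙z≈xz∙y (ν unitWeight 1 E (g ∷ X)) _ _)
                     (cong (λ z → (ν unitWeight 1 E (g ∷ X) + z) + ν unitWeight 1 (incident g E) X)
                       (onlyIf-cong (avoid? d X) (avoid? d (g ∷ X)) free-without-g (avoid-⊆ there) refl)))
      where
      free-without-g : Avoid d X → Avoid d (g ∷ X)
      free-without-g (a , b) = ∉-∷ (λ e → nt (inj₁ (sym e))) a , ∉-∷ (λ e → nt (inj₂ (sym e))) b

    ν1-≥1 : ∀ F X {d} → Unique F → d ∈ F → Avoid d X → 1 ≤ ν unitWeight 1 F X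
    ν1-≥1 F X {d} u m a = subst (1 ≤_) (sym (ν-extract unitWeight 0 F d X u m))
      (subst (λ z → 1 ≤ ν unitWeight 1 (remove d F) X + z) (sym (onlyIf-yes (avoid? d X) a)) (m≤n+m 1 _))

    ν1-≥2 : ∀ F X {d1 d2} → Unique F → d1 ∈ F → d2 ∈ F → d1 ≢ d2 → Avoid d1 X → Avoid d2 X → 2 ≤ ν unitWeight 1 F X
    ν1-≥2 F X {d1} {d2} u m1 m2 ne a1 a2 = subst (2 ≤_) (sym (ν-extract unitWeight 0 F d1 X u m1))
      (subst (λ z → 2 ≤ ν unitWeight 1 (remove d1 F) X + z) (sym (onlyIf-yes (avoid? d1 X) a1))
        (+-mono-≤ (ν1-≥1 (remove d1 F) X (remove-unique d1 u) (remove-∈⁺ m2 (ne ∘ sym)) a2) (≤-refl {1})))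

    heavy-edge-decomposition : ∀ (wt : Ed → ℕ) k E e A → Unique E → e ∈ E →
      (∀ {d} → d ∈ E → d ≢ e → wt d ≡ 1) → wt e ≡ A →
      ν wt (suc k) E [] + ν unitWeight k E (cover e []) ≡ ν unitWeight (suc k) E [] + A * ν unitWeight k E (cover e [])
    heavy-edge-decomposition wt k E e A uE eE light wA = begin
        ν wt (suc k) E [] + y
          ≡⟨ cong (_+ y) (trans (ν-extract wt k E e [] uE eE) (cong (ν wt (suc k) R [] +_) (onlyIf-yes (avoid? e []) e-free))) ⟩
        (ν wt (suc k) R [] + wt e * ν wt k R eX) + y
          ≡⟨ cong₂ (λ s t → (s + t) + y) (ν-cong-weight wt unitWeight (suc k) R [] light-R)
                   (cong₂ _*_ wA (trans (ν-cong-weight wt unitWeight k R eX light-R) (sym (ν-remove-blocked unitWeight k E e eX e-used)))) ⟩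
        (r + A * y) + y ≡⟨ xy∙z≈xz∙y r (A * y) y ⟩
        (r + y) + A * y
          ≡⟨ cong (_+ A * y) (trans (cong (r +_) (trans (ν-remove-blocked unitWeight k E e eX e-used) (sym (*-identityˡ _))))
                               (trans (cong (r +_) (sym (onlyIf-yes (avoid? e []) e-free))) (sym (ν-extract unitWeight k E e [] uE eE)))) ⟩
        ν unitWeight (suc k) E [] + A * y ∎
      where
      open ≡-Reasoning
      R : List Ed
      R = remove e E
      eX : List V
      eX = cover e []
      r : ℕ
      r = ν unitWeight (suc k) R []
      y : ℕ
      y = ν unitWeight k E eX
      e-free : Avoid e []
      e-free = (λ ()) , (λ ())
      e-used : ¬ Avoid e eX
      e-used (a , _) = a (here refl)
      light-R : ∀ {d} → d ∈ R → wt d ≡ unitWeight d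
      light-R m = let (a , b) = remove-∈⁻ m in light a b


module EdgeList where

  open import Data.Nat using (ℕ)
  import Data.Nat as N
  open import Data.Fin as F using (Fin)
  open import Data.List using (List; []; _∷_; map; filter; concatMap; allFin)
  import Data.List.Relation.Unary.Any as Any
  open import Data.List.Membership.Propositional using (_∈_; find)
  open import Data.List.Membership.Propositional.Properties
    using (∈-concatMap⁻; ∈-concatMap⁺; ∈-map⁻; ∈-map⁺; ∈-filter⁻; ∈-filter⁺; ∈-allFin)
  open import Data.List.Relation.Unary.Unique.Propositional using (Unique)
  import Data.List.Relation.Unary.Unique.Propositional.Properties as UP
  open import Data.List.Relation.Unary.AllPairs using ([]; _∷_)
  open import Data.List.Relation.Unary.All.Properties using (All¬⇒¬Any)
  open import Data.Product using (_×_; _,_; proj₁; proj₂)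
  open import Relation.Nullary using (¬_; Dec)
  open import Relation.Nullary.Decidable using (¬?)
  open import Relation.Binary.PropositionalEquality
  open import Defs

  module _ {n : ℕ} where

    row : Fin n → List (Edge n)
    row i = map (λ j → (i , j)) (filter (λ j → i F.<? j) (allFin n))

    ∈-pairs⁻ : ∀ {d} → d ∈ pairs n → proj₁ d F.< proj₂ d
    ∈-pairs⁻ {d} m with find (∈-concatMap⁻ row {xs = allFin n} m)
    ... | i , _ , m2 with ∈-map⁻ (λ j → (i , j)) m2
    ... | j , m3 , refl = proj₂ (∈-filter⁻ (λ j → i F.<? j) {xs = allFin n} m3)

    ∈-pairs⁺ : ∀ {i j} → i F.< j → (i , j) ∈ pairs n
    ∈-pairs⁺ {i} {j} lt = ∈-concatMap⁺ row {xs = allFin n}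
      (Any.map (λ { refl → ∈-map⁺ (λ j → (i , j)) (∈-filter⁺ (λ j → i F.<? j) (∈-allFin j) lt) }) (∈-allFin i))

    row-fst : ∀ i {d} → d ∈ row i → proj₁ d ≡ i
    row-fst i m with ∈-map⁻ (λ j → (i , j)) m
    ... | j , _ , refl = refl

    row-unique : ∀ i → Unique (row i)
    row-unique i = UP.map⁺ (λ { refl → refl }) (UP.filter⁺ (λ j → i F.<? j) (UP.allFin⁺ n))

    -- Rows of distinct vertices are disjoint, so their concatenation has no repetition.
    rows-unique : ∀ {xs : List (Fin n)} → Unique xs → Unique (concatMap row xs)
    rows-unique {[]} [] = []
    rows-unique {x ∷ xs} (px ∷ u) = UP.++⁺ (row-unique x) (rows-unique u) disjoint
      where
      disjoint : ∀ {v} → ¬ (v ∈ row x × v ∈ concatMap row xs)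
      disjoint (m1 , m2) with find (∈-concatMap⁻ row {xs = xs} m2)
      ... | y , my , m3 = All¬⇒¬Any px (Any.map (λ { refl → trans (sym (row-fst x m1)) (row-fst y m3) }) my)

    pairs-unique : Unique (pairs n)
    pairs-unique = rows-unique (UP.allFin⁺ n)

    module _ (w : WGraph n) where
      nonzero? : (e : Edge n) → Dec (¬ (w (proj₁ e) (proj₂ e) ≡ 0))
      nonzero? e = ¬? (w (proj₁ e) (proj₂ e) N.≟ 0)

      edges-unique : Unique (edges w)
      edges-unique = UP.filter⁺ nonzero? pairs-unique

      ∈-edges⁻ : ∀ {d} → d ∈ edges w → (proj₁ d F.< proj₂ d) × w (proj₁ d) (proj₂ d) ≢ 0
      ∈-edges⁻ m = let (a , b) = ∈-filter⁻ nonzero? {xs = pairs n} m in ∈-pairs⁻ a , b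

      ∈-edges⁺ : ∀ {i j} → i F.< j → w i j ≢ 0 → (i , j) ∈ edges w
      ∈-edges⁺ lt nz = ∈-filter⁺ nonzero? (∈-pairs⁺ lt) nz


-- More generally the sum over sublists S of E
-- that are k-matchings avoiding X satisfies the same recursion as ν: split the
-- sublists by whether they contain the first edge d.
module Coefficients where

  open import Data.Nat using (ℕ; zero; suc; _+_; _*_; _^_)
  import Data.Nat as N
  open import Data.Nat.Properties using (suc-injective; *-zeroʳ; +-identityʳ; <-irrefl)
  open import Data.Fin as F using (toℕ)
  open import Data.List using (List; []; _∷_; _++_; map; filter; length)
  open import Data.List.Properties using (filter-accept; filter-reject; filter-++; map-++; map-∘; filter-≐; filter-none; ++-identityʳ)
  open import Data.Nat.ListAction using (sum; product)
  open import Data.Nat.ListAction.Properties using (sum-++)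
  open import Data.List.Relation.Unary.Any using (here; there)
  open import Data.List.Membership.Propositional using (_∈_)
  open import Data.List.Membership.Propositional.Properties using (∈-++⁺ʳ)
  open import Data.List.Relation.Unary.Unique.Propositional using (Unique)
  import Data.List.Relation.Unary.Unique.DecPropositional as UD
  open import Data.List.Relation.Unary.AllPairs using ([]; _∷_)
  open import Data.List.Relation.Unary.All using (_∷_)
  import Data.List.Relation.Unary.All as All
  import Data.List.Relation.Unary.All.Properties as AllP
  open import Data.Product using (_×_; _,_; proj₁; proj₂)
  open import Relation.Nullary using (yes; no)
  open import Relation.Nullary.Decidable using (_×-dec_)
  open import Relation.Unary using (Decidable)
  open import Relation.Binary.PropositionalEquality
  open import Function using (_∘_)
  open import Defs
  open Matchings
  open ListFacts
  open EdgeList using (∈-edges⁻)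

  module AsMatchingCount {n : ℕ} (w : WGraph n) where
    open Counting n

    sqWeight : Ed → ℕ
    sqWeight d = w (proj₁ d) (proj₂ d) ^ 2

    weightProduct : List Ed → ℕ
    weightProduct S = product (map sqWeight S)

    Partial : ℕ → List V → List Ed → Set
    Partial k X S = (length S ≡ k) × Unique (endpoints S ++ X)

    Partial? : ∀ k X → Decidable (Partial k X)
    Partial? k X S = (length S N.≟ k) ×-dec UD.unique? F._≟_ (endpoints S ++ X)

    matchingSum : ℕ → List Ed → List V → ℕ
    matchingSum k E X = sum (map weightProduct (filter (Partial? k X) (sublists E)))

    Loopless : List Ed → Set
    Loopless E = ∀ {d} → d ∈ E → proj₁ d ≢ proj₂ d

    with-first : ∀ k d E X → sum (map weightProduct (filter (Partial? k X) (map (d ∷_) (sublists E))))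
                           ≡ sqWeight d * sum (map weightProduct (filter (Partial? k X ∘ (d ∷_)) (sublists E)))
    with-first k d E X = begin
        sum (map weightProduct (filter (Partial? k X) (map (d ∷_) (sublists E))))
          ≡⟨ cong (sum ∘ map weightProduct) (filter-map (Partial? k X) (d ∷_) (sublists E)) ⟩
        sum (map weightProduct (map (d ∷_) Sd))
          ≡⟨ cong sum (sym (map-∘ Sd)) ⟩
        sum (map (λ S → sqWeight d * weightProduct S) Sd)
          ≡⟨ sum-scale (sqWeight d) weightProduct Sd ⟩
        sqWeight d * sum (map weightProduct Sd) ∎
      where
      open ≡-Reasoning
      Sd : List (List Ed)
      Sd = filter (Partial? k X ∘ (d ∷_)) (sublists E)

    matchingSum≡ν : ∀ k E X → Loopless E → Unique X → matchingSum k E X ≡ ν sqWeight k E X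
    matchingSum≡ν zero [] X ll uX rewrite filter-accept (Partial? 0 X) {[]} {[]} (refl , uX) = refl
    matchingSum≡ν (suc k) [] X ll uX rewrite filter-reject (Partial? (suc k) X) {[]} {[]} (λ { (() , _) }) = refl
    matchingSum≡ν k (d ∷ E) X ll uX = begin
        matchingSum k (d ∷ E) X
          ≡⟨ cong (sum ∘ map weightProduct) (filter-++ (Partial? k X) (sublists E) (map (d ∷_) (sublists E))) ⟩
        sum (map weightProduct (filter (Partial? k X) (sublists E) ++ filter (Partial? k X) (map (d ∷_) (sublists E))))
          ≡⟨ cong sum (map-++ weightProduct (filter (Partial? k X) (sublists E)) _) ⟩
        sum (map weightProduct (filter (Partial? k X) (sublists E)) ++ map weightProduct (filter (Partial? k X) (map (d ∷_) (sublists E))))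
          ≡⟨ sum-++ (map weightProduct (filter (Partial? k X) (sublists E))) _ ⟩
        matchingSum k E X + sum (map weightProduct (filter (Partial? k X) (map (d ∷_) (sublists E))))
          ≡⟨ cong₂ _+_ (matchingSum≡ν k E X (ll ∘ there) uX) (with-first k d E X) ⟩
        ν sqWeight k E X + sqWeight d * sum (map weightProduct (filter (Partial? k X ∘ (d ∷_)) (sublists E)))
          ≡⟨ using-d k ⟩
        ν sqWeight k (d ∷ E) X ∎
      where
      open ≡-Reasoning
      d-loopless : proj₁ d ≢ proj₂ d
      d-loopless = ll (here refl)
      d-free : ∀ k S → Partial (suc k) X (d ∷ S) → Avoid d X
      d-free k S (_ , (p₁ ∷ (p₂ ∷ u))) = (λ m → All.lookup p₁ (there (∈-++⁺ʳ (endpoints S) m)) refl) ,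
                                         (λ m → All.lookup p₂ (∈-++⁺ʳ (endpoints S) m) refl)
      using-d : ∀ k → ν sqWeight k E X + sqWeight d * sum (map weightProduct (filter (Partial? k X ∘ (d ∷_)) (sublists E)))
                    ≡ ν sqWeight k (d ∷ E) X
      using-d zero rewrite filter-none (Partial? 0 X ∘ (d ∷_)) {sublists E} (All.universal (λ { S (() , _) }) _) | *-zeroʳ (sqWeight d) = +-identityʳ _
      using-d (suc k) with avoid? d X
      ... | no busy
        rewrite filter-none (Partial? (suc k) X ∘ (d ∷_)) {sublists E} (All.universal (λ S pk → busy (d-free k S pk)) _)
              | *-zeroʳ (sqWeight d) = refl
      ... | yes (aX , bX) = cong (ν sqWeight (suc k) E X +_) (cong (sqWeight d *_) (trans (cong (sum ∘ map weightProduct)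
              (filter-≐ {P = λ S → Partial (suc k) X (d ∷ S)} (Partial? (suc k) X ∘ (d ∷_)) (Partial? k (cover d X))
                        ((λ {S} → fwd {S}) , (λ {S} → bwd {S})) (sublists E)))
              (matchingSum≡ν k E (cover d X) (ll ∘ there) unique-cover)))
        where
        unique-cover : Unique (cover d X)
        unique-cover = (d-loopless ∷ AllP.¬Any⇒All¬ X aX) ∷ (AllP.¬Any⇒All¬ X bX ∷ uX)
        fwd : ∀ {S} → Partial (suc k) X (d ∷ S) → Partial k (cover d X) S
        fwd {S} (l , u) = suc-injective l , unique-move (proj₁ d) (endpoints S) (proj₂ d ∷ X)
                                              (unique-move (proj₂ d) (proj₁ d ∷ endpoints S) X (unique-swap u))
        bwd : ∀ {S} → Partial k (cover d X) S → Partial (suc k) X (d ∷ S)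
        bwd {S} (l , u) = cong suc l , unique-swap (unique-move⁻ (proj₂ d) (proj₁ d ∷ endpoints S) X
                                                     (unique-move⁻ (proj₁ d) (endpoints S) (proj₂ d ∷ X) u))

    b≡ν : ∀ k → b k w ≡ ν sqWeight k (edges w) []
    b≡ν k = trans (cong (sum ∘ map weightProduct) (filter-≐ (isKMatching? k) (Partial? k [])
                     ((λ { (l , u) → l , subst Unique (sym (++-identityʳ _)) u }) ,
                      (λ { (l , u) → l , subst Unique (++-identityʳ _) u })) (sublists (edges w))))
                  (matchingSum≡ν k (edges w) [] (λ m e → <-irrefl (cong toℕ e) (proj₁ (∈-edges⁻ w m))) [])


-- Starting from a free edge of an acyclic graph we walk
-- along free vertices without revisiting any; the walk has at most n vertices,
-- and where it stops the current end v has no free neighbour off the walk.  A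
-- free neighbour on the walk other than its predecessor would close a cycle, so
-- the last edge is the only free edge at v: a leaf edge relative to X.
module Leaves where

  open import Data.Nat using (ℕ; zero; suc; _+_; _≤_; _<_; z≤n; s≤s)
  import Data.Nat as N
  open import Data.Nat.Properties using (+-suc; +-identityʳ; m≤n+m; m<n+m; <⇒≱; <-irrefl; <-asym)
  open import Data.Fin as F using (Fin)
  import Data.Fin.Properties as FP
  open import Data.List using (List; []; _∷_; _++_; length; allFin)
  open import Data.List.Properties using (length-++; ++-assoc; length-tabulate)
  open import Data.List.Relation.Unary.Any using (here; there; any?)
  import Data.List.Relation.Unary.Any as Any
  open import Data.List.Membership.Propositional using (_∈_; _∉_; find)
  open import Data.List.Membership.Propositional.Properties using (∈-allFin; ∈-∃++)
  open import Data.List.Relation.Unary.Unique.Propositional using (Unique)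
  open import Data.List.Relation.Unary.AllPairs using ([]; _∷_)
  open import Data.List.Relation.Unary.All using (All; []; _∷_)
  import Data.List.Relation.Unary.All as All
  import Data.List.Relation.Unary.All.Properties as AllP
  open import Data.Product using (_×_; _,_; proj₁; proj₂; Σ)
  open import Data.Sum using (inj₁; inj₂)
  open import Data.Empty using (⊥; ⊥-elim)
  open import Relation.Nullary using (¬_; yes; no)
  open import Relation.Nullary.Decidable using (_×-dec_; ¬?)
  open import Relation.Binary.PropositionalEquality
  open import Relation.Binary.Definitions using (tri<; tri≈; tri>)
  open import Defs
  open Matchings
  open EdgeList
  open ListFacts

  module LeafSearch (n : ℕ) (w : WGraph n) (symw : ∀ i j → w i j ≡ w j i) (loop : ∀ i → w i i ≡ 0) where
    open Counting n

    E : List Ed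
    E = edges w

    adj-sym : ∀ {i j} → Adj w i j → Adj w j i
    adj-sym {i} {j} a e = a (trans (symw i j) e)

    data Chain : List V → Set where
      c0 : Chain []
      c1 : ∀ {x} → Chain (x ∷ [])
      c2 : ∀ {x y L} → Adj w x y → Chain (y ∷ L) → Chain (x ∷ y ∷ L)

    chain-head : ∀ {x y L} → Chain (x ∷ y ∷ L) → Adj w x y
    chain-head (c2 a _) = a

    chain-prefix : ∀ xs {ys} → Chain (xs ++ ys) → Chain xs
    chain-prefix [] c = c0
    chain-prefix (x ∷ []) c = c1
    chain-prefix (x ∷ y ∷ xs) (c2 a c) = c2 a (chain-prefix (y ∷ xs) c)

    lastOf : V → List V → V
    lastOf x [] = x
    lastOf x (y ∷ L) = lastOf y L

    lastOf-snoc : ∀ x L h → lastOf x (L ++ h ∷ []) ≡ h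
    lastOf-snoc x [] h = refl
    lastOf-snoc x (y ∷ L) h = lastOf-snoc y L h

    chain⇒cyclePath : ∀ {first x L} → Chain (x ∷ L) → Adj w (lastOf x L) first → CyclePath w first (x ∷ L)
    chain⇒cyclePath {L = []} _ a = last a
    chain⇒cyclePath {L = y ∷ L} (c2 a c) b = cons a (chain⇒cyclePath c b)

    no-cycle : Acyclic w → ∀ v u pre h post → Chain (v ∷ u ∷ pre ++ h ∷ post) →
      Unique (v ∷ u ∷ pre ++ h ∷ post) → Adj w h v → ⊥
    no-cycle acyc v u pre h post ch un a =
      acyc C (length-C , unique-prefix C (subst Unique split un) ,
              chain⇒cyclePath (chain-prefix C (subst Chain split ch)) (subst (λ z → Adj w z v) (sym (lastOf-snoc u pre h)) a))
      where
      C : List V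
      C = v ∷ u ∷ pre ++ h ∷ []
      split : v ∷ u ∷ pre ++ h ∷ post ≡ C ++ post
      split = sym (cong (λ z → v ∷ u ∷ z) (++-assoc pre (h ∷ []) post))
      length-C : 3 ≤ length C
      length-C = s≤s (s≤s (subst (1 ≤_) (sym (length-++ pre)) (m≤n+m 1 (length pre))))

    edge-between : (f g : V) → f ≢ g → Adj w f g → Σ Ed λ e → e ∈ E × Ends e f g
    edge-between f g ne a with FP.<-cmp f g
    ... | tri< lt _ _ = (f , g) , ∈-edges⁺ w lt a , inj₁ (refl , refl)
    ... | tri≈ _ eq _ = ⊥-elim (ne eq)
    ... | tri> _ _ gt = (g , f) , ∈-edges⁺ w gt (adj-sym a) , inj₂ (refl , refl)

    ends-unique : ∀ {d1 d2 f g} → d1 ∈ E → d2 ∈ E → Ends d1 f g → Ends d2 f g → d1 ≡ d2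
    ends-unique m1 m2 (inj₁ (refl , refl)) (inj₁ (refl , refl)) = refl
    ends-unique m1 m2 (inj₂ (refl , refl)) (inj₂ (refl , refl)) = refl
    ends-unique m1 m2 (inj₁ (refl , refl)) (inj₂ (refl , refl)) = ⊥-elim (<-asym (proj₁ (∈-edges⁻ w m1)) (proj₁ (∈-edges⁻ w m2)))
    ends-unique m1 m2 (inj₂ (refl , refl)) (inj₁ (refl , refl)) = ⊥-elim (<-asym (proj₁ (∈-edges⁻ w m1)) (proj₁ (∈-edges⁻ w m2)))

    ends-adj : ∀ {d f h} → d ∈ E → Ends d f h → Adj w f h
    ends-adj m (inj₁ (refl , refl)) = proj₂ (∈-edges⁻ w m)
    ends-adj m (inj₂ (refl , refl)) = adj-sym (proj₂ (∈-edges⁻ w m))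

    ends-distinct : ∀ {e f g} → e ∈ E → Ends e f g → f ≢ g
    ends-distinct m (inj₁ (refl , refl)) eq = <-irrefl (cong F.toℕ eq) (proj₁ (∈-edges⁻ w m))
    ends-distinct m (inj₂ (refl , refl)) eq = <-irrefl (cong F.toℕ (sym eq)) (proj₁ (∈-edges⁻ w m))

    record FreeLeaf (X : List V) : Set where
      constructor freeLeaf
      field
        edge : Ed
        leaf other : V
        edge∈ : edge ∈ E
        ends : Ends edge leaf other
        leaf-free : leaf ∉ X
        other-free : other ∉ X
        only-edge : ∀ {d} → d ∈ E → TouchV leaf d → d ≢ edge → ¬ Avoid d X

    module _ (acyc : Acyclic w) (X : List V) where
      -- Extend the walk v u rest at v while a free new neighbour exists; fuel m
      -- with n < length + m guarantees termination by the pigeonhole principle.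
      walk : ∀ m v u rest → Chain (v ∷ u ∷ rest) → Unique (v ∷ u ∷ rest) → All (_∉ X) (v ∷ u ∷ rest) →
             n < length (v ∷ u ∷ rest) + m → FreeLeaf X
      walk zero v u rest ch un al lt = ⊥-elim (<⇒≱ (subst (n <_) (+-identityʳ _) lt)
        (subst (length (v ∷ u ∷ rest) ≤_) (length-tabulate {n = n} (λ x → x)) (unique-length-≤ un (λ {x} _ → ∈-allFin x))))
      walk (suc m) v u rest ch un al lt
        with any? (λ h → (¬? (h ∈? X)) ×-dec ((¬? (w v h N.≟ 0)) ×-dec (¬? (h ∈? (v ∷ u ∷ rest))))) (allFin n)
      ... | yes a with find a
      ...   | h , _ , (hX , adj , h-new) = walk m h v (u ∷ rest) (c2 (adj-sym adj) ch) (AllP.¬Any⇒All¬ _ h-new ∷ un) (hX ∷ al)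
                                           (subst (n <_) (+-suc _ m) lt)
      walk (suc m) v u rest ch un al lt | no stuck = freeLeaf e v u e∈E e-ends (All.head al) (All.head (All.tail al)) only-e
        where
        vu : v ≢ u
        vu = λ eq → unique-head un (here eq)
        found : Σ Ed λ d → d ∈ E × Ends d v u
        found = edge-between v u vu (chain-head ch)
        e : Ed
        e = proj₁ found
        e∈E : e ∈ E
        e∈E = proj₁ (proj₂ found)
        e-ends : Ends e v u
        e-ends = proj₂ (proj₂ found)
        only-e : ∀ {d} → d ∈ E → TouchV v d → d ≢ e → ¬ Avoid d X
        only-e {d} dm t dne av with touch-other t
        ... | h , dh with ends-avoid⁻ dh av | ends-adj dm dh
        ...   | (_ , hX) | avh with h ∈? (v ∷ u ∷ rest)
        ...     | no h-new = stuck (Any.map (λ { refl → hX , avh , h-new }) (∈-allFin h))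
        ...     | yes (here refl) = avh (loop v)
        ...     | yes (there (here refl)) = dne (ends-unique dm e∈E dh e-ends)
        ...     | yes (there (there m')) with ∈-∃++ m'
        ...       | pre , post , refl = no-cycle acyc v u pre h post ch un (adj-sym avh)

      leaf : ∀ {d} → d ∈ E → Avoid d X → FreeLeaf X
      leaf {d} dm (aX , bX) = walk n (proj₁ d) (proj₂ d) [] (c2 (proj₂ (∈-edges⁻ w dm)) c1)
        ((ends-distinct dm (inj₁ (refl , refl)) ∷ []) ∷ [] ∷ []) (aX ∷ bX ∷ []) (m<n+m n (s≤s z≤n))


-- Here p(N, k) = pathCount N k is the
-- number of k-matchings of the path on N vertices, determined by the leaf
-- recursion p(N+2, k+1) = p(N+1, k+1) + p(N, k).  Relative to a set X of used
-- vertices, N is the number α X of free vertices.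
module ForestBound where

  open import Data.Nat using (ℕ; zero; suc; _+_; _≤_; z≤n)
  open import Data.Nat.Properties using (≤-refl; +-mono-≤; *-identityˡ; 0≢1+n; suc-injective)
  import Data.Fin as F
  open import Data.List using (List; []; _∷_; length; allFin; filter)
  open import Data.List.Properties using (filter-accept; filter-reject; filter-all; length-tabulate)
  open import Data.List.Relation.Unary.Any using (here; there; any?)
  import Data.List.Relation.Unary.Any as Any
  open import Data.List.Membership.Propositional using (_∈_; _∉_; find)
  open import Data.List.Membership.Propositional.Properties using (∈-allFin)
  open import Data.List.Relation.Unary.Unique.Propositional using (Unique)
  import Data.List.Relation.Unary.Unique.Propositional.Properties as UP
  open import Data.List.Relation.Unary.AllPairs using (_∷_)
  import Data.List.Relation.Unary.All as All
  open import Data.Product using (_,_)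
  open import Data.Sum using (_⊎_; inj₁; inj₂)
  open import Data.Empty using (⊥-elim)
  open import Relation.Nullary using (¬_; Dec; yes; no)
  open import Relation.Nullary.Decidable using (¬?)
  open import Relation.Binary.PropositionalEquality
  open import Function using (_∘_)
  open import Defs
  open Matchings
  open EdgeList
  open ListFacts
  open Leaves

  pathCount : ℕ → ℕ → ℕ
  pathCount _ zero = 1
  pathCount zero (suc k) = 0
  pathCount (suc zero) (suc k) = 0
  pathCount (suc (suc N)) (suc k) = pathCount (suc N) (suc k) + pathCount N k

  module FreeVertices (n : ℕ) where
    open Counting n

    free? : (X : List V) (v : V) → Dec (v ∉ X)
    free? X v = ¬? (v ∈? X)

    α : List V → ℕ
    α X = length (filter (free? X) (allFin n))

    free-then-equal : ∀ {x f : V} {X : List V} → x ∉ X → ¬ (x ∉ f ∷ X) → x ≡ f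
    free-then-equal {x} {f} xX used with x F.≟ f
    ... | yes e = e
    ... | no ne = ⊥-elim (used (∉-∷ ne xX))

    count-remove : ∀ {f X} (L : List V) → Unique L → f ∈ L → f ∉ X →
      length (filter (free? X) L) ≡ suc (length (filter (free? (f ∷ X)) L))
    count-remove {f} {X} (x ∷ L) (px ∷ u) m fX with free? X x | free? (f ∷ X) x
    ... | yes xX | yes xfX rewrite filter-accept (free? X) {x} {L} xX | filter-accept (free? (f ∷ X)) {x} {L} xfX with m
    ...   | here eq = ⊥-elim (xfX (here (sym eq)))
    ...   | there m' = cong suc (count-remove L u m' fX)
    count-remove {f} {X} (x ∷ L) (px ∷ u) m fX | yes xX | no nxfX
      rewrite filter-accept (free? X) {x} {L} xX | filter-reject (free? (f ∷ X)) {x} {L} nxfX with m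
    ...   | there m' = ⊥-elim (All.lookup px m' (free-then-equal xX nxfX))
    ...   | here refl = cong suc (same L (λ m'' → All.lookup px m'' refl))
      where
      same : ∀ L' → x ∉ L' → length (filter (free? X) L') ≡ length (filter (free? (x ∷ X)) L')
      same [] _ = refl
      same (y ∷ L') ni with free? X y | free? (x ∷ X) y
      ... | yes a | yes b rewrite filter-accept (free? X) {y} {L'} a | filter-accept (free? (x ∷ X)) {y} {L'} b = cong suc (same L' (ni ∘ there))
      ... | no a | no b rewrite filter-reject (free? X) {y} {L'} a | filter-reject (free? (x ∷ X)) {y} {L'} b = same L' (ni ∘ there)
      ... | yes a | no b = ⊥-elim (b (∉-∷ (λ eq → ni (here (sym eq))) a))
      ... | no a | yes b = ⊥-elim (a (b ∘ there))
    count-remove {f} {X} (x ∷ L) (px ∷ u) m fX | no nxX | yes xfX = ⊥-elim (nxX (xfX ∘ there))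
    count-remove {f} {X} (x ∷ L) (px ∷ u) m fX | no nxX | no nxfX
      rewrite filter-reject (free? X) {x} {L} nxX | filter-reject (free? (f ∷ X)) {x} {L} nxfX with m
    ...   | here refl = ⊥-elim (nxX fX)
    ...   | there m' = count-remove L u m' fX

    α-remove : ∀ {f X} → f ∉ X → α X ≡ suc (α (f ∷ X))
    α-remove {f} fX = count-remove (allFin n) (UP.allFin⁺ n) (∈-allFin f) fX

    α-[] : α [] ≡ n
    α-[] = trans (cong length (filter-all (free? []) (All.universal (λ v ()) (allFin n)))) (length-tabulate {n = n} (λ z → z))

    α-pair : ∀ {f g : V} → f ≢ g → n ≡ suc (suc (α (f ∷ g ∷ [])))
    α-pair {f} {g} f≢g = trans (sym α-[]) (trans (α-remove {g} {[]} (λ ()))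
                           (cong suc (α-remove {f} {g ∷ []} (∉-∷ f≢g (λ ())))))

  module InForest (n : ℕ) (w : WGraph n) (symw : ∀ i j → w i j ≡ w j i) (loop : ∀ i → w i i ≡ 0) (acyc : Acyclic w) where
    open Counting n
    open FreeVertices n
    open LeafSearch n w symw loop public

    uE : Unique E
    uE = edges-unique w

    free-edge-or-none : ∀ X → FreeLeaf X ⊎ (∀ {d} → d ∈ E → ¬ Avoid d X)
    free-edge-or-none X with any? (λ d → avoid? d X) E
    ... | no none = inj₂ (λ m a → none (Any.map (λ { refl → a }) m))
    ... | yes some with find some
    ...   | d , dm , av = inj₁ (leaf acyc X dm av)

    module AtLeaf {X} (L : FreeLeaf X) where
      open FreeLeaf L renaming (leaf to f; other to g)

      f∷X : List V
      f∷X = f ∷ X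

      g∷f∷X : List V
      g∷f∷X = g ∷ f ∷ X

      α-leaf : α X ≡ suc (α f∷X)
      α-leaf = α-remove leaf-free

      α-other : α f∷X ≡ suc (α g∷f∷X)
      α-other = α-remove (∉-∷ (≢-sym (ends-distinct edge∈ ends)) other-free)

      split : ∀ k → ν unitWeight (suc k) E X ≡ ν unitWeight (suc k) E f∷X + ν unitWeight k E g∷f∷X
      split k = trans (leaf-split unitWeight k E edge f g X uE edge∈ ends leaf-free other-free only-edge)
                      (cong (ν unitWeight (suc k) E f∷X +_) (trans (*-identityˡ _) (ν-cong-used unitWeight k E swap-front)))

    forest-bound : ∀ N X → α X ≡ N → ∀ k → ν unitWeight k E X ≤ pathCount N k
    forest-bound N X eα zero = ≤-refl
    forest-bound N X eα (suc k) with free-edge-or-none X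
    ... | inj₂ none = subst (_≤ pathCount N (suc k)) (sym (ν-no-free-edge unitWeight k E X none)) z≤n
    ... | inj₁ L = bound-at N eα
      where
      open AtLeaf L
      bound-at : ∀ N → α X ≡ N → ν unitWeight (suc k) E X ≤ pathCount N (suc k)
      bound-at zero eα = ⊥-elim (0≢1+n (trans (sym eα) α-leaf))
      bound-at (suc zero) eα = ⊥-elim (0≢1+n (trans (sym (suc-injective (trans (sym α-leaf) eα))) α-other))
      bound-at (suc (suc N)) eα = subst (_≤ pathCount (suc (suc N)) (suc k)) (sym (split k))
        (+-mono-≤ (forest-bound (suc N) f∷X (suc-injective (trans (sym α-leaf) eα)) (suc k))
                  (forest-bound N g∷f∷X (suc-injective (trans (sym α-other) (suc-injective (trans (sym α-leaf) eα)))) k))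


-- If m_k(F) = p(N, k) for every k, then
-- the free vertices of F carry an induced Hamiltonian path: a bijection
-- φ : Fin N → free vertices with φ p, φ q adjacent iff |p - q| = 1.  Induction
-- along the leaf recursion: removing a leaf edge fg preserves the equalities
-- (both summands of the recurrence are bounded separately), so the rest is a
-- path; g has at most one free neighbour besides f (m_1 counts edges), hence g
-- is an end of that path, and f is attached in front of it.
module EqualityCase where

  open import Data.Nat using (ℕ; zero; suc; _+_; _∸_; _≤_; _<_; z≤n; s≤s)
  import Data.Nat as N
  open import Data.Nat.Properties
  open import Data.Fin as F using (Fin; toℕ; opposite)
  import Data.Fin.Properties as FP
  open import Data.List using (List; _∷_; length; allFin; filter)
  open import Data.List.Relation.Unary.Any using (here; there)
  open import Data.List.Membership.Propositional using (_∈_; _∉_)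
  open import Data.List.Membership.Propositional.Properties using (∈-filter⁺; ∈-filter⁻; ∈-allFin)
  open import Data.Product using (_×_; _,_; proj₁; proj₂; Σ)
  open import Data.Sum using (_⊎_; inj₁; inj₂)
  open import Data.Empty using (⊥; ⊥-elim)
  open import Relation.Nullary using (¬_; Dec; yes; no)
  open import Relation.Binary.PropositionalEquality
  open import Function using (_∘_)
  open import Defs
  open Matchings
  open ListFacts
  open ForestBound

  Consecutiveℕ : ℕ → ℕ → Set
  Consecutiveℕ x y = y ≡ suc x ⊎ x ≡ suc y

  Consecutiveℕ? : ∀ x y → Dec (Consecutiveℕ x y)
  Consecutiveℕ? x y with y N.≟ suc x | x N.≟ suc y
  ... | yes e | _ = yes (inj₁ e)
  ... | no _ | yes e = yes (inj₂ e)
  ... | no e1 | no e2 = no λ { (inj₁ e) → e1 e ; (inj₂ e) → e2 e }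

  Consecutive : ∀ {N} → Fin N → Fin N → Set
  Consecutive p q = Consecutiveℕ (toℕ p) (toℕ q)

  Consecutive-sym : ∀ {N} {p q : Fin N} → Consecutive p q → Consecutive q p
  Consecutive-sym (inj₁ e) = inj₂ e
  Consecutive-sym (inj₂ e) = inj₁ e

  Consecutive-irrefl : ∀ {N} {p : Fin N} → ¬ Consecutive p p
  Consecutive-irrefl (inj₁ e) = <-irrefl e (n<1+n _)
  Consecutive-irrefl (inj₂ e) = <-irrefl e (n<1+n _)

  ∸-sucʳ : ∀ N m → m < N → N ∸ m ≡ suc (N ∸ suc m)
  ∸-sucʳ (suc N) zero _ = refl
  ∸-sucʳ (suc N) (suc m) (s≤s lt) = ∸-sucʳ N m lt

  Consecutive-opposite : ∀ {N} {p q : Fin N} → Consecutive p q → Consecutive (opposite p) (opposite q)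
  Consecutive-opposite {N} {p} {q} (inj₁ e) = inj₂ (begin
      toℕ (opposite p) ≡⟨ FP.opposite-prop p ⟩
      N ∸ suc (toℕ p) ≡⟨ ∸-sucʳ N (suc (toℕ p)) (subst (_< N) e (FP.toℕ<n q)) ⟩
      suc (N ∸ suc (suc (toℕ p))) ≡⟨ cong (λ z → suc (N ∸ suc z)) (sym e) ⟩
      suc (N ∸ suc (toℕ q)) ≡⟨ cong suc (sym (FP.opposite-prop q)) ⟩
      suc (toℕ (opposite q)) ∎)
    where open ≡-Reasoning
  Consecutive-opposite {N} {p} {q} (inj₂ e) = Consecutive-sym (Consecutive-opposite {p = q} {q = p} (inj₁ e))

  Consecutive-opposite⁻ : ∀ {N} {p q : Fin N} → Consecutive (opposite p) (opposite q) → Consecutive p q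
  Consecutive-opposite⁻ {N} {p} {q} c =
    subst₂ Consecutive (FP.opposite-involutive p) (FP.opposite-involutive q) (Consecutive-opposite c)

  pathCount-1 : ∀ N → pathCount N 1 ≡ N ∸ 1
  pathCount-1 zero = refl
  pathCount-1 (suc zero) = refl
  pathCount-1 (suc (suc N)) = trans (cong (_+ 1) (pathCount-1 (suc N))) (+-comm N 1)

  +-tight-split : ∀ {a b A B} → a ≤ A → b ≤ B → a + b ≡ A + B → a ≡ A × b ≡ B
  +-tight-split {a} {b} {A} {B} aA bB e = ea , +-cancelˡ-≡ a b B (trans e (cong (_+ B) (sym ea)))
    where
    ea : a ≡ A
    ea = ≤-antisym aA (+-cancelʳ-≤ B A a (≤-trans (≤-reflexive (sym e)) (+-monoʳ-≤ a bB)))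

  module InducedPaths (n : ℕ) (w : WGraph n) (symw : ∀ i j → w i j ≡ w j i) (loop : ∀ i → w i i ≡ 0) where
    open Matchings.Counting n

    record InducedPath (X : List V) (N : ℕ) (φ : Fin N → V) : Set where
      field
        inj : ∀ {p q} → φ p ≡ φ q → p ≡ q
        cov : ∀ v → v ∉ X → Σ (Fin N) λ p → φ p ≡ v
        inX : ∀ p → φ p ∉ X
        adj⇒ : ∀ p q → w (φ p) (φ q) ≢ 0 → Consecutive p q
        ⇒adj : ∀ p q → Consecutive p q → w (φ p) (φ q) ≢ 0

    induced-reverse : ∀ {X N φ} → InducedPath X N φ → InducedPath X N (φ ∘ opposite)
    induced-reverse {X} {N} {φ} ip = record
      { inj = λ e → trans (sym (FP.opposite-involutive _)) (trans (cong opposite (InducedPath.inj ip e)) (FP.opposite-involutive _))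
      ; cov = λ v nv → let (q , e) = InducedPath.cov ip v nv in opposite q , trans (cong φ (FP.opposite-involutive q)) e
      ; inX = λ q → InducedPath.inX ip (opposite q)
      ; adj⇒ = λ a b nz → Consecutive-opposite⁻ (InducedPath.adj⇒ ip (opposite a) (opposite b) nz)
      ; ⇒adj = λ a b c → InducedPath.⇒adj ip (opposite a) (opposite b) (Consecutive-opposite c)
      }

    prepend : ∀ {A : Set} {N} → A → (Fin N → A) → Fin (suc N) → A
    prepend a φ F.zero = a
    prepend a φ (F.suc q) = φ q

    induced-extend : ∀ {X N} {ψ : Fin (suc N) → V} (f : V) → f ∉ X → InducedPath (f ∷ X) (suc N) ψ →
      (∀ h → h ∉ X → w f h ≢ 0 → h ≡ ψ F.zero) → w f (ψ F.zero) ≢ 0 →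
      InducedPath X (suc (suc N)) (prepend f ψ)
    induced-extend {X} {N} {ψ} f fX ip only fadj = record { inj = inj' ; cov = cov' ; inX = inX' ; adj⇒ = adj⇒' ; ⇒adj = ⇒adj' }
      where
      module P = InducedPath ip
      inj' : ∀ {p q} → prepend f ψ p ≡ prepend f ψ q → p ≡ q
      inj' {F.zero} {F.zero} e = refl
      inj' {F.zero} {F.suc q} e = ⊥-elim (P.inX q (here (sym e)))
      inj' {F.suc p} {F.zero} e = ⊥-elim (P.inX p (here e))
      inj' {F.suc p} {F.suc q} e = cong F.suc (P.inj e)
      cov' : ∀ v → v ∉ X → Σ (Fin (suc (suc N))) λ p → prepend f ψ p ≡ v
      cov' v nv with v F.≟ f
      ... | yes refl = F.zero , refl
      ... | no ne = let (q , e) = P.cov v (∉-∷ ne nv) in F.suc q , e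
      inX' : ∀ p → prepend f ψ p ∉ X
      inX' F.zero = fX
      inX' (F.suc q) m = P.inX q (there m)
      at-head : ∀ q → w f (ψ q) ≢ 0 → q ≡ F.zero
      at-head q nz = P.inj (only (ψ q) (λ m → P.inX q (there m)) nz)
      adj⇒' : ∀ p q → w (prepend f ψ p) (prepend f ψ q) ≢ 0 → Consecutive p q
      adj⇒' F.zero F.zero nz = ⊥-elim (nz (loop f))
      adj⇒' F.zero (F.suc q) nz with at-head q nz
      ... | refl = inj₁ refl
      adj⇒' (F.suc p) F.zero nz with at-head p (λ e → nz (trans (symw (ψ p) f) e))
      ... | refl = inj₂ refl
      adj⇒' (F.suc p) (F.suc q) nz with P.adj⇒ p q nz
      ... | inj₁ e = inj₁ (cong suc e)
      ... | inj₂ e = inj₂ (cong suc e)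
      ⇒adj' : ∀ p q → Consecutive p q → w (prepend f ψ p) (prepend f ψ q) ≢ 0
      ⇒adj' F.zero F.zero c = ⊥-elim (Consecutive-irrefl {p = F.zero {suc N}} c)
      ⇒adj' F.zero (F.suc F.zero) c = fadj
      ⇒adj' F.zero (F.suc (F.suc q)) (inj₁ ())
      ⇒adj' F.zero (F.suc (F.suc q)) (inj₂ ())
      ⇒adj' (F.suc F.zero) F.zero c = λ e → fadj (trans (symw f (ψ F.zero)) e)
      ⇒adj' (F.suc (F.suc p)) F.zero (inj₁ ())
      ⇒adj' (F.suc (F.suc p)) F.zero (inj₂ ())
      ⇒adj' (F.suc p) (F.suc q) (inj₁ e) = P.⇒adj p q (inj₁ (suc-injective e))
      ⇒adj' (F.suc p) (F.suc q) (inj₂ e) = P.⇒adj p q (inj₂ (suc-injective e))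

  no-excess-degree : ∀ M d → 1 ≤ M → 2 ≤ d → M ≡ (M ∸ 1) + d → ⊥
  no-excess-degree (suc M') d _ le e = <-irrefl e (≤-trans (≤-reflexive (+-comm 2 M')) (+-monoʳ-≤ M' le))

  module Rigidity (n : ℕ) (w : WGraph n) (symw : ∀ i j → w i j ≡ w j i) (loop : ∀ i → w i i ≡ 0) (acyc : Acyclic w) where
    open Matchings.Counting n
    open FreeVertices n
    open InForest n w symw loop acyc
    open InducedPaths n w symw loop

    induced-path-base : ∀ X N → α X ≡ N → pathCount N 1 ≡ 0 → Σ (Fin N → V) (InducedPath X N)
    induced-path-base X zero eα _ =
      (λ p → ⊥-elim (no-fin p)) , record { inj = λ {p} → ⊥-elim (no-fin p) ; cov = none-free ; inX = λ () ; adj⇒ = λ () ; ⇒adj = λ () }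
      where
      no-fin : Fin 0 → ⊥
      no-fin ()
      none-free : ∀ v → v ∉ X → Σ (Fin 0) λ p → ⊥-elim (no-fin p) ≡ v
      none-free v nv = ⊥-elim (nonempty (∈-filter⁺ (free? X) (∈-allFin v) nv) eα)
        where
        nonempty : ∀ {v : V} {L : List V} → v ∈ L → length L ≡ 0 → ⊥
        nonempty {L = _ ∷ _} _ ()
    induced-path-base X (suc zero) eα _ with length≡1⇒singleton (filter (free? X) (allFin n)) eα
    ... | x , eL = (λ _ → x) , record { inj = one-point ; cov = only-x ; inX = λ _ → x-free
                                      ; adj⇒ = λ _ _ nz → ⊥-elim (nz (loop x))
                                      ; ⇒adj = λ { F.zero F.zero c → ⊥-elim (Consecutive-irrefl {p = F.zero {0}} c) } }
      where
      one-point : ∀ {p q : Fin 1} → x ≡ x → p ≡ q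
      one-point {F.zero} {F.zero} _ = refl
      x-free : x ∉ X
      x-free = proj₂ (∈-filter⁻ (free? X) {xs = allFin n} (subst (x ∈_) (sym eL) (here refl)))
      only-x : ∀ v → v ∉ X → Σ (Fin 1) λ _ → x ≡ v
      only-x v nv with subst (v ∈_) eL (∈-filter⁺ (free? X) (∈-allFin v) nv)
      ... | here e = F.zero , sym e
    induced-path-base X (suc (suc N)) eα e = ⊥-elim (0≢1+n (sym (trans (sym (pathCount-1 (suc (suc N)))) e)))

    -- An
    -- interior position would give g two free edges.
    orient-at : ∀ {Y : List V} {M} (g : V) (φ : Fin (suc M) → V) → InducedPath Y (suc M) φ → g ∉ Y →
      M ≡ (M ∸ 1) + ν unitWeight 1 (incident g E) Y →
      Σ (Fin (suc M) → V) λ ψ → InducedPath Y (suc M) ψ × ψ F.zero ≡ g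
    orient-at {Y} {M} g φ ip gY degree with InducedPath.cov ip g gY
    ... | F.zero , eq = φ , ip , eq
    ... | F.suc q' , eq with suc (toℕ q') N.<? M
    ...   | no not-interior = (φ ∘ opposite) , induced-reverse ip , trans (cong φ last-is-g) eq
      where
      last-is-g : opposite (F.zero {M}) ≡ F.suc q'
      last-is-g = FP.toℕ-injective (trans (FP.opposite-prop (F.zero {M}))
                    (≤-antisym (≮⇒≥ not-interior) (N.s≤s⁻¹ (FP.toℕ<n (F.suc q')))))
    ...   | yes interior = ⊥-elim (no-excess-degree M _ (≤-trans (s≤s z≤n) interior) two-free-edges degree)
      where
      module P = InducedPath ip
      q : Fin (suc M)
      q = F.suc q'
      prev next : Fin (suc M)
      prev = F.inject₁ q'
      next = F.fromℕ< (s≤s interior)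
      to-prev : toℕ prev ≡ toℕ q'
      to-prev = FP.toℕ-inject₁ q'
      to-next : toℕ next ≡ suc (suc (toℕ q'))
      to-next = FP.toℕ-fromℕ< (s≤s interior)
      g≢prev : g ≢ φ prev
      g≢prev e' = <-irrefl (sym (trans (cong toℕ (P.inj (trans eq e'))) to-prev)) (n<1+n (toℕ q'))
      g≢next : g ≢ φ next
      g≢next e' = <-irrefl (trans (cong toℕ (P.inj (trans eq e'))) to-next) (n<1+n _)
      to-prev-edge : Σ Ed λ d → d ∈ E × Ends d g (φ prev)
      to-prev-edge = edge-between g (φ prev) g≢prev
        (subst (λ z → w z (φ prev) ≢ 0) eq (P.⇒adj q prev (inj₂ (cong suc (sym to-prev)))))
      to-next-edge : Σ Ed λ d → d ∈ E × Ends d g (φ next)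
      to-next-edge = edge-between g (φ next) g≢next
        (subst (λ z → w z (φ next) ≢ 0) eq (P.⇒adj q next (inj₁ to-next)))
      distinct : proj₁ to-prev-edge ≢ proj₁ to-next-edge
      distinct e' = <-irrefl (sym (trans (sym to-next) (trans (cong toℕ (sym (P.inj (ends-same
                      (subst (λ z → Ends z g (φ prev)) e' (proj₂ (proj₂ to-prev-edge))) (proj₂ (proj₂ to-next-edge))))))
                      to-prev))) (≤-trans (n<1+n _) (n≤1+n _))
      two-free-edges : 2 ≤ ν unitWeight 1 (incident g E) Y
      two-free-edges = ν1-≥2 (incident g E) Y (incident-unique g uE)
        (incident-∈ (proj₁ (proj₂ to-prev-edge)) (ends-touch (proj₂ (proj₂ to-prev-edge))))
        (incident-∈ (proj₁ (proj₂ to-next-edge)) (ends-touch (proj₂ (proj₂ to-next-edge)))) distinct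
        (ends-avoid⁺ (proj₂ (proj₂ to-prev-edge)) gY (P.inX prev)) (ends-avoid⁺ (proj₂ (proj₂ to-next-edge)) gY (P.inX next))

    module LeafOfExtremal {X M} (L : FreeLeaf X) (eα : α X ≡ suc (suc M))
                          (eqs : ∀ k → ν unitWeight k E X ≡ pathCount (suc (suc M)) k) where
      open AtLeaf L public
      open FreeLeaf L renaming (leaf to f; other to g)

      α-f : α f∷X ≡ suc M
      α-f = suc-injective (trans (sym α-leaf) eα)

      α-g : α g∷f∷X ≡ M
      α-g = suc-injective (trans (sym α-other) α-f)

      -- each summand of the recurrence meets its bound, so both are equalities
      both : ∀ k → ν unitWeight (suc k) E f∷X ≡ pathCount (suc M) (suc k) × ν unitWeight k E g∷f∷X ≡ pathCount M k
      both k = +-tight-split (forest-bound (suc M) f∷X α-f (suc k)) (forest-bound M g∷f∷X α-g k)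
                 (trans (sym (split k)) (eqs (suc k)))

      eqs-f : ∀ k → ν unitWeight k E f∷X ≡ pathCount (suc M) k
      eqs-f zero = refl
      eqs-f (suc k) = proj₁ (both k)

      -- comparing m_1 before and after covering g: g has at most one free edge
      degree : M ≡ (M ∸ 1) + ν unitWeight 1 (incident g E) f∷X
      degree = begin
          M ≡⟨ sym (pathCount-1 (suc M)) ⟩
          pathCount (suc M) 1 ≡⟨ sym (eqs-f 1) ⟩
          ν unitWeight 1 E f∷X ≡⟨ ν1-split-at E f∷X g ⟩
          ν unitWeight 1 E g∷f∷X + ν unitWeight 1 (incident g E) f∷X
            ≡⟨ cong (_+ ν unitWeight 1 (incident g E) f∷X) (trans (proj₂ (both 1)) (pathCount-1 M)) ⟩
          (M ∸ 1) + ν unitWeight 1 (incident g E) f∷X ∎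
        where open ≡-Reasoning

      attach-leaf : Σ (Fin (suc M) → V) (InducedPath f∷X (suc M)) → Σ (Fin (suc (suc M)) → V) (InducedPath X (suc (suc M)))
      attach-leaf (φ , ip) = prepend f ψ , induced-extend f leaf-free (proj₁ (proj₂ oriented)) only-g f-adj-head
        where
        oriented : Σ (Fin (suc M) → V) λ ψ → InducedPath f∷X (suc M) ψ × ψ F.zero ≡ g
        oriented = orient-at g φ ip (∉-∷ (≢-sym (ends-distinct edge∈ ends)) other-free) degree
        ψ : Fin (suc M) → V
        ψ = proj₁ oriented
        head-g : ψ F.zero ≡ g
        head-g = proj₂ (proj₂ oriented)
        only-g : ∀ h → h ∉ X → w f h ≢ 0 → h ≡ ψ F.zero
        only-g h hX nz with h F.≟ g
        ... | yes h≡g = trans h≡g (sym head-g)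
        ... | no h≢g = ⊥-elim (only-edge (proj₁ (proj₂ fh)) (ends-touch (proj₂ (proj₂ fh))) not-e
                                (ends-avoid⁺ (proj₂ (proj₂ fh)) leaf-free hX))
          where
          fh : Σ Ed λ d → d ∈ E × Ends d f h
          fh = edge-between f h (λ { refl → nz (loop f) }) nz
          not-e : proj₁ fh ≢ edge
          not-e eq = h≢g (ends-same (subst (λ z → Ends z f h) eq (proj₂ (proj₂ fh))) ends)
        f-adj-head : w f (ψ F.zero) ≢ 0
        f-adj-head = subst (λ z → w f z ≢ 0) (sym head-g) (ends-adj edge∈ ends)

    equality⇒induced-path : ∀ N X → α X ≡ N → (∀ k → ν unitWeight k E X ≡ pathCount N k) → Σ (Fin N → V) (InducedPath X N)
    equality⇒induced-path N X eα eqs with free-edge-or-none X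
    ... | inj₂ none = induced-path-base X N eα (trans (sym (eqs 1)) (ν-no-free-edge unitWeight 0 E X none))
    equality⇒induced-path zero X eα eqs | inj₁ L = ⊥-elim (0≢1+n (trans (sym eα) (AtLeaf.α-leaf L)))
    equality⇒induced-path (suc zero) X eα eqs | inj₁ L =
      ⊥-elim (0≢1+n (trans (sym (suc-injective (trans (sym (AtLeaf.α-leaf L)) eα))) (AtLeaf.α-other L)))
    equality⇒induced-path (suc (suc M)) X eα eqs | inj₁ L =
      LeafOfExtremal.attach-leaf L eα eqs
        (equality⇒induced-path (suc M) (AtLeaf.f∷X L) (LeafOfExtremal.α-f L eα eqs) (LeafOfExtremal.eqs-f L eα eqs))


module PathStarShape where

  open import Data.Nat using (ℕ; zero; suc)
  import Data.Nat as N
  open import Data.Nat.Properties using (suc-injective; 0≢1+n)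
  open import Data.Fin using (Fin; toℕ)
  open import Data.Sum using (_⊎_; inj₁; inj₂)
  open import Data.Product using (_×_; _,_)
  open import Data.Empty using (⊥-elim)
  open import Relation.Nullary using (¬_; Dec; yes; no)
  open import Relation.Binary.PropositionalEquality
  open import Defs
  open EqualityCase using (Consecutiveℕ; Consecutiveℕ?)

  HeavyPair : ℕ → ℕ → Set
  HeavyPair x y = (x ≡ 0 × y ≡ 1) ⊎ (x ≡ 1 × y ≡ 0)

  HeavyPair? : ∀ x y → Dec (HeavyPair x y)
  HeavyPair? zero zero = no λ { (inj₁ (_ , ())) ; (inj₂ (() , _)) }
  HeavyPair? zero (suc zero) = yes (inj₁ (refl , refl))
  HeavyPair? zero (suc (suc y)) = no λ { (inj₁ (_ , ())) ; (inj₂ (() , _)) }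
  HeavyPair? (suc zero) zero = yes (inj₂ (refl , refl))
  HeavyPair? (suc zero) (suc y) = no λ { (inj₁ (() , _)) ; (inj₂ (_ , ())) }
  HeavyPair? (suc (suc x)) y = no λ { (inj₁ (() , _)) ; (inj₂ (() , _)) }

  unitIfConsecutive : ℕ → ℕ → ℕ
  unitIfConsecutive zero zero = 0
  unitIfConsecutive zero (suc zero) = 1
  unitIfConsecutive zero (suc (suc _)) = 0
  unitIfConsecutive (suc x) (suc y) = unitIfConsecutive x y
  unitIfConsecutive (suc zero) zero = 1
  unitIfConsecutive (suc (suc _)) zero = 0

  Consecutiveℕ-suc : ∀ {x y} → ¬ Consecutiveℕ (suc x) (suc y) → ¬ Consecutiveℕ x y
  Consecutiveℕ-suc h (inj₁ e) = h (inj₁ (cong suc e))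
  Consecutiveℕ-suc h (inj₂ e) = h (inj₂ (cong suc e))

  unitIfConsecutive-yes : ∀ x y → Consecutiveℕ x y → unitIfConsecutive x y ≡ 1
  unitIfConsecutive-yes zero .1 (inj₁ refl) = refl
  unitIfConsecutive-yes (suc zero) .0 (inj₂ refl) = refl
  unitIfConsecutive-yes (suc x) .(suc (suc x)) (inj₁ refl) = unitIfConsecutive-yes x (suc x) (inj₁ refl)
  unitIfConsecutive-yes (suc (suc y)) (suc y) (inj₂ refl) = unitIfConsecutive-yes (suc y) y (inj₂ refl)

  unitIfConsecutive-no : ∀ x y → ¬ Consecutiveℕ x y → unitIfConsecutive x y ≡ 0
  unitIfConsecutive-no zero zero _ = refl
  unitIfConsecutive-no zero (suc zero) h = ⊥-elim (h (inj₁ refl))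
  unitIfConsecutive-no zero (suc (suc y)) _ = refl
  unitIfConsecutive-no (suc zero) zero h = ⊥-elim (h (inj₂ refl))
  unitIfConsecutive-no (suc (suc x)) zero _ = refl
  unitIfConsecutive-no (suc x) (suc y) h = unitIfConsecutive-no x y (Consecutiveℕ-suc h)

  pathStarℕ : ℕ → ℕ → ℕ → ℕ
  pathStarℕ a zero zero = 0
  pathStarℕ a zero (suc zero) = a
  pathStarℕ a zero (suc (suc y)) = 0
  pathStarℕ a (suc x) (suc y) = unitIfConsecutive x y
  pathStarℕ a (suc zero) zero = a
  pathStarℕ a (suc (suc x)) zero = 0

  pathStar≡ℕ : ∀ {n} a (i j : Fin n) → pathStar n a i j ≡ pathStarℕ a (toℕ i) (toℕ j)
  pathStar≡ℕ {n} a i j with toℕ i | toℕ j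
  ... | zero | suc zero = refl
  ... | suc zero | zero = refl
  ... | zero | zero = refl
  ... | zero | suc (suc y) = refl
  ... | suc (suc x) | zero = refl
  ... | suc zero | suc y with 2 N.≟ suc y | suc (suc y) N.≟ 1
  ...   | yes e | _ = sym (unitIfConsecutive-yes 1 (suc y) (inj₁ (sym e)))
  ...   | no _ | yes e = sym (unitIfConsecutive-yes 1 (suc y) (inj₂ (sym e)))
  ...   | no e1 | no e2 = sym (unitIfConsecutive-no 1 (suc y) λ { (inj₁ e) → e1 (sym e) ; (inj₂ e) → e2 (sym e) })
  pathStar≡ℕ {n} a i j | suc (suc x) | suc y with suc (suc (suc x)) N.≟ suc y | suc (suc y) N.≟ suc (suc x)
  ...   | yes e | _ = sym (unitIfConsecutive-yes (suc (suc x)) (suc y) (inj₁ (sym e)))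
  ...   | no _ | yes e = sym (unitIfConsecutive-yes (suc (suc x)) (suc y) (inj₂ (sym e)))
  ...   | no e1 | no e2 = sym (unitIfConsecutive-no (suc (suc x)) (suc y) λ { (inj₁ e) → e1 (sym e) ; (inj₂ e) → e2 (sym e) })

  pathStarℕ-heavy : ∀ a x y → HeavyPair x y → pathStarℕ a x y ≡ a
  pathStarℕ-heavy a .0 .1 (inj₁ (refl , refl)) = refl
  pathStarℕ-heavy a .1 .0 (inj₂ (refl , refl)) = refl

  pathStarℕ-light : ∀ a x y → Consecutiveℕ x y → ¬ HeavyPair x y → pathStarℕ a x y ≡ 1
  pathStarℕ-light a zero zero (inj₁ ())
  pathStarℕ-light a zero zero (inj₂ ())
  pathStarℕ-light a zero (suc zero) h not-heavy = ⊥-elim (not-heavy (inj₁ (refl , refl)))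
  pathStarℕ-light a zero (suc (suc y)) (inj₁ ())
  pathStarℕ-light a zero (suc (suc y)) (inj₂ ())
  pathStarℕ-light a (suc x) (suc y) (inj₁ e) _ = unitIfConsecutive-yes x y (inj₁ (suc-injective e))
  pathStarℕ-light a (suc x) (suc y) (inj₂ e) _ = unitIfConsecutive-yes x y (inj₂ (suc-injective e))
  pathStarℕ-light a (suc zero) zero h not-heavy = ⊥-elim (not-heavy (inj₂ (refl , refl)))
  pathStarℕ-light a (suc (suc x)) zero (inj₁ ())
  pathStarℕ-light a (suc (suc x)) zero (inj₂ ())

  pathStarℕ-absent : ∀ a x y → ¬ Consecutiveℕ x y → pathStarℕ a x y ≡ 0
  pathStarℕ-absent a zero zero h = refl
  pathStarℕ-absent a zero (suc zero) h = ⊥-elim (h (inj₁ refl))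
  pathStarℕ-absent a zero (suc (suc y)) h = refl
  pathStarℕ-absent a (suc x) (suc y) h = unitIfConsecutive-no x y (Consecutiveℕ-suc h)
  pathStarℕ-absent a (suc zero) zero h = ⊥-elim (h (inj₂ refl))
  pathStarℕ-absent a (suc (suc x)) zero h = refl

  pathStarℕ-nonzero : ∀ a x y → a ≢ 0 → Consecutiveℕ x y → pathStarℕ a x y ≢ 0
  pathStarℕ-nonzero a x y a≢0 h with HeavyPair? x y
  ... | yes heavy = λ e → a≢0 (trans (sym (pathStarℕ-heavy a x y heavy)) e)
  ... | no light = λ e → 0≢1+n (sym (trans (sym (pathStarℕ-light a x y h light)) e))

  pathStarℕ-consecutive : ∀ a x y → pathStarℕ a x y ≢ 0 → Consecutiveℕ x y
  pathStarℕ-consecutive a x y nz with Consecutiveℕ? x y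
  ... | yes h = h
  ... | no h = ⊥-elim (nz (pathStarℕ-absent a x y h))


-- With the first j vertices used, the free vertices of
-- P* form a path on r = n - j vertices, and ν follows the leaf recursion at the
-- free vertex j, giving p(r, k).
module PathStarCounts where

  open import Data.Nat using (ℕ; zero; suc; _+_; _*_; _^_; _≤_; _<_; z≤n; s≤s)
  import Data.Nat as N
  open import Data.Nat.Properties
  open import Data.Fin as F using (Fin; toℕ)
  import Data.Fin.Properties as FP
  open import Data.List using (List; []; _∷_; allFin; filter)
  open import Data.List.Relation.Unary.Any using (here; there)
  open import Data.List.Membership.Propositional using (_∈_)
  open import Data.List.Membership.Propositional.Properties using (∈-filter⁺; ∈-filter⁻; ∈-allFin)
  open import Data.Product using (_,_; proj₁; proj₂)
  open import Data.Sum using (inj₁; inj₂)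
  open import Data.Empty using (⊥-elim)
  open import Relation.Nullary using (¬_; yes; no)
  open import Relation.Binary.PropositionalEquality
  open import Defs
  open Matchings
  open EdgeList
  open Coefficients
  open ForestBound using (pathCount)
  open PathStarShape

  module OnPathStar (n : ℕ) (a : ℕ) (a≢0 : a ≢ 0) where
    open Counting n

    P : WGraph n
    P = pathStar n a
    E* : List Ed
    E* = edges P

    initial : ℕ → List V
    initial j = filter (λ v → toℕ v N.<? j) (allFin n)

    initial⁺ : ∀ {j v} → toℕ v < j → v ∈ initial j
    initial⁺ {j} {v} lt = ∈-filter⁺ (λ v → toℕ v N.<? j) (∈-allFin v) lt

    initial⁻ : ∀ {j v} → v ∈ initial j → toℕ v < j
    initial⁻ {j} {v} m = proj₂ (∈-filter⁻ (λ v → toℕ v N.<? j) {xs = allFin n} m)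

    initial-suc : ∀ {f : V} {j} → toℕ f ≡ j → SameSet (f ∷ initial j) (initial (suc j))
    initial-suc {f} {j} e = fw , bw
      where
      fw : (f ∷ initial j) ⊆ initial (suc j)
      fw (here refl) = initial⁺ (s≤s (≤-reflexive e))
      fw (there m) = initial⁺ (≤-trans (initial⁻ m) (n≤1+n _))
      bw : initial (suc j) ⊆ (f ∷ initial j)
      bw {v} m with toℕ v N.<? j
      ... | yes lt = there (initial⁺ lt)
      ... | no nlt = here (FP.toℕ-injective (trans (≤-antisym (N.s≤s⁻¹ (initial⁻ m)) (≮⇒≥ nlt)) (sym e)))

    E*⁻ : ∀ {d} → d ∈ E* → toℕ (proj₂ d) ≡ suc (toℕ (proj₁ d))
    E*⁻ {d} m with ∈-edges⁻ P m
    ... | lt , nz with pathStarℕ-consecutive a (toℕ (proj₁ d)) (toℕ (proj₂ d)) (λ e → nz (trans (pathStar≡ℕ a (proj₁ d) (proj₂ d)) e))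
    ...   | inj₁ e = e
    ...   | inj₂ e = ⊥-elim (<-asym lt (subst (toℕ (proj₂ d) <_) (sym e) (n<1+n _)))

    E*⁺ : ∀ {i j : V} → toℕ j ≡ suc (toℕ i) → (i , j) ∈ E*
    E*⁺ {i} {j} e = ∈-edges⁺ P (subst (toℕ i <_) (sym e) (n<1+n _))
      (λ z → pathStarℕ-nonzero a (toℕ i) (toℕ j) a≢0 (inj₁ e) (trans (sym (pathStar≡ℕ a i j)) z))

    pathStar-ν : ∀ r j → j + r ≡ n → ∀ k → ν unitWeight k E* (initial j) ≡ pathCount r k
    pathStar-ν r j e zero = refl
    pathStar-ν zero j e (suc k) = ν-no-free-edge unitWeight k E* (initial j) λ {d} m (a1 , _) →
      a1 (initial⁺ (≤-trans (n≤1+n _) (subst (λ z → suc z ≤ j) (E*⁻ m) (below-j d))))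
      where
      below-j : ∀ d → toℕ (proj₂ d) < j
      below-j d = subst (toℕ (proj₂ d) <_) (trans (sym e) (+-identityʳ j)) (FP.toℕ<n (proj₂ d))
    pathStar-ν (suc zero) j e (suc k) = ν-no-free-edge unitWeight k E* (initial j) λ {d} m (a1 , a2) → a1 (initial⁺ (first-below d m a2))
      where
      -- only the vertex j is free, so an edge with a free second end starts below j
      first-below : ∀ d → d ∈ E* → ¬ proj₂ d ∈ initial j → toℕ (proj₁ d) < j
      first-below d m a2 with toℕ (proj₁ d) N.<? j
      ... | yes lt = lt
      ... | no nlt = ⊥-elim (<-irrefl refl (≤-trans (FP.toℕ<n (proj₂ d))
                      (≤-trans (≤-reflexive (trans (sym e) (+-comm j 1))) (≤-trans (s≤s (≮⇒≥ nlt)) (≤-reflexive (sym (E*⁻ m)))))))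
    pathStar-ν (suc (suc r)) j e (suc k) =
      trans split (cong₂ _+_ (trans (ν-cong-used unitWeight (suc k) E* (initial-suc to-f))
                                    (pathStar-ν (suc r) (suc j) (trans (sym (+-suc j (suc r))) e) (suc k)))
                             (trans (*-identityˡ _) (trans (ν-cong-used unitWeight k E* (ss-trans swap-front (ss-trans (ss-∷ (initial-suc to-f)) (initial-suc to-g))))
                                 (pathStar-ν r (suc (suc j)) e' k))))
      where
      e' : suc (suc (j + r)) ≡ n
      e' = trans (sym (trans (+-suc j (suc r)) (cong suc (+-suc j r)))) e
      j<n : j < n
      j<n = subst (j <_) e' (s≤s (≤-trans (m≤m+n j r) (n≤1+n _)))
      j+1<n : suc j < n
      j+1<n = subst (suc j <_) e' (s≤s (s≤s (m≤m+n j r)))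
      f g : V
      f = F.fromℕ< j<n
      g = F.fromℕ< j+1<n
      to-f : toℕ f ≡ j
      to-f = FP.toℕ-fromℕ< j<n
      to-g : toℕ g ≡ suc j
      to-g = FP.toℕ-fromℕ< j+1<n
      only-fg : ∀ {d} → d ∈ E* → TouchV f d → d ≢ (f , g) → ¬ Avoid d (initial j)
      only-fg {d1 , d2} m (inj₁ refl) ne _ = ne (cong (f ,_) (FP.toℕ-injective (trans (E*⁻ m) (trans (cong suc to-f) (sym to-g)))))
      only-fg {d1 , d2} m (inj₂ refl) ne (a1 , _) = a1 (initial⁺ (subst (toℕ d1 <_) (trans (sym (E*⁻ m)) to-f) (n<1+n _)))
      split : ν unitWeight (suc k) E* (initial j) ≡ ν unitWeight (suc k) E* (f ∷ initial j) + 1 * ν unitWeight k E* (f ∷ g ∷ initial j)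
      split = leaf-split unitWeight k E* (f , g) f g (initial j) (edges-unique P) (E*⁺ (trans to-g (cong suc (sym to-f)))) (inj₁ (refl , refl))
                (λ m → <-irrefl to-f (initial⁻ m)) (λ m → 1+n≰n (≤-trans (n≤1+n (suc j)) (subst (λ z → suc z ≤ j) to-g (initial⁻ m)))) only-fg

  module PendentEdge (N a : ℕ) (a≢0 : a ≢ 0) where
    open Counting (suc (suc N))
    open OnPathStar (suc (suc N)) a a≢0 public
    open AsMatchingCount P

    e₀ : Ed
    e₀ = (F.zero , F.suc F.zero)

    light-edges-P : ∀ {d} → d ∈ E* → d ≢ e₀ → P (proj₁ d) (proj₂ d) ≡ 1
    light-edges-P {d1 , d2} m ne = trans (pathStar≡ℕ a d1 d2) (pathStarℕ-light a (toℕ d1) (toℕ d2) (inj₁ (E*⁻ m)) not-heavy)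
      where
      not-heavy : ¬ HeavyPair (toℕ d1) (toℕ d2)
      not-heavy (inj₁ (z1 , o2)) = ne (cong₂ _,_ (FP.toℕ-injective z1) (FP.toℕ-injective o2))
      not-heavy (inj₂ (o1 , z2)) = 0≢1+n (trans (sym z2) (trans (E*⁻ m) (cong suc o1)))

    counts : ∀ k → ν unitWeight k E* [] ≡ pathCount (suc (suc N)) k
    counts k = trans (ν-cong-used unitWeight k E* ((λ ()) , (λ m → ⊥-elim (n≮0 (initial⁻ m)))))
                     (pathStar-ν (suc (suc N)) 0 refl k)

    counts-without-e₀ : ∀ k → ν unitWeight k E* (cover e₀ []) ≡ pathCount N k
    counts-without-e₀ k = trans (ν-cong-used unitWeight k E* first-two) (pathStar-ν N 2 refl k)
      where
      first-two : SameSet (cover e₀ []) (initial 2)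
      first-two = fw , bw
        where
        fw : cover e₀ [] ⊆ initial 2
        fw (here refl) = initial⁺ {2} {F.zero} (s≤s z≤n)
        fw (there (here refl)) = initial⁺ {2} {F.suc F.zero} (s≤s (s≤s z≤n))
        bw : initial 2 ⊆ cover e₀ []
        bw {v} m = below-2 v (initial⁻ m)
          where
          below-2 : ∀ v → toℕ v < 2 → v ∈ cover e₀ []
          below-2 F.zero _ = here refl
          below-2 (F.suc F.zero) _ = there (here refl)
          below-2 (F.suc (F.suc _)) (s≤s (s≤s ()))

    P-decomposition : ∀ k → b (suc k) P + pathCount N k ≡ pathCount (suc (suc N)) (suc k) + a ^ 2 * pathCount N k
    P-decomposition k = begin
        b (suc k) P + pathCount N k ≡⟨ cong₂ _+_ (b≡ν (suc k)) (sym (counts-without-e₀ k)) ⟩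
        ν sqWeight (suc k) E* [] + ν unitWeight k E* (cover e₀ [])
          ≡⟨ heavy-edge-decomposition sqWeight k E* e₀ (a ^ 2) (edges-unique P) (E*⁺ refl)
               (λ m ne → cong (_^ 2) (light-edges-P m ne)) (cong (_^ 2) (pathStar≡ℕ a (F.zero {suc N}) (F.suc F.zero))) ⟩
        ν unitWeight (suc k) E* [] + a ^ 2 * ν unitWeight k E* (cover e₀ [])
          ≡⟨ cong₂ (λ s t → s + a ^ 2 * t) (counts (suc k)) (counts-without-e₀ k) ⟩
        pathCount (suc (suc N)) (suc k) + a ^ 2 * pathCount N k ∎
      where open ≡-Reasoning


module Comparison where

  open import Data.Nat using (zero; suc; _+_; _*_; _≤_; _<_; s≤s; _/_)
  import Data.Nat as N
  open import Data.Nat.Properties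
  open import Data.Nat.DivMod using (/-monoˡ-≤; m*n/n≡m)
  open import Data.Nat.Tactic.RingSolver using (solve-∀)
  open import Data.Product using (_×_; _,_; proj₁; proj₂)
  open import Data.Empty using (⊥-elim)
  open import Relation.Nullary using (¬_; yes; no)
  open import Relation.Binary.PropositionalEquality
  open ForestBound using (pathCount)
  open EqualityCase using (+-tight-split)

  pathCount-vanishes : ∀ N k → N < k * 2 → pathCount N k ≡ 0
  pathCount-vanishes N zero ()
  pathCount-vanishes zero (suc k) _ = refl
  pathCount-vanishes (suc zero) (suc k) _ = refl
  pathCount-vanishes (suc (suc N)) (suc k) (s≤s (s≤s lt)) =
    cong₂ _+_ (pathCount-vanishes (suc N) (suc k) (s≤s (s≤s (≤-trans (n≤1+n _) lt)))) (pathCount-vanishes N k lt)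

  above-half : ∀ n k → ¬ (k ≤ n / 2) → n < k * 2
  above-half n k k≰n/2 with k * 2 N.≤? n
  ... | yes le = ⊥-elim (k≰n/2 (subst (_≤ n / 2) (m*n/n≡m k 2) (/-monoˡ-≤ 2 le)))
  ... | no nle = ≰⇒> nle

  solve-decomposition : ∀ {b y x A'} → b + y ≡ x + suc A' * y → b ≡ x + A' * y
  solve-decomposition {b} {y} {x} {A'} e = +-cancelʳ-≡ y b (x + A' * y) (trans e (regroup x y A'))
    where
    regroup : ∀ x y A' → x + suc A' * y ≡ (x + A' * y) + y
    regroup = solve-∀

  decomposition-≤ : ∀ {bT y x bP Y X A} → bT + y ≡ x + A * y → bP + Y ≡ X + A * Y →
    x ≤ X → y ≤ Y → 1 ≤ A → bT ≤ bP
  decomposition-≤ {bT} {y} {x} {bP} {Y} {X} {suc A'} eT eP x≤X y≤Y _ =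
    subst₂ _≤_ (sym (solve-decomposition {bT} {y} {x} {A'} eT)) (sym (solve-decomposition {bP} {Y} {X} {A'} eP))
      (+-mono-≤ x≤X (*-monoʳ-≤ A' y≤Y))

  decomposition-≡ : ∀ {bT y x bP Y X A} → bT + y ≡ x + A * y → bP + Y ≡ X + A * Y →
    x ≤ X → y ≤ Y → 2 ≤ A → bT ≡ bP → x ≡ X × y ≡ Y
  decomposition-≡ {A = suc zero} _ _ _ _ (s≤s ()) _
  decomposition-≡ {bT} {y} {x} {bP} {Y} {X} {suc (suc A'')} eT eP x≤X y≤Y _ bT≡bP =
    proj₁ tight , *-cancelˡ-≡ y Y (suc A'') (proj₂ tight)
    where
    tight : x ≡ X × suc A'' * y ≡ suc A'' * Y
    tight = +-tight-split x≤X (*-monoʳ-≤ (suc A'') y≤Y)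
              (trans (sym (solve-decomposition {bT} {y} {x} {suc A''} eT)) (trans bT≡bP (solve-decomposition {bP} {Y} {X} {suc A''} eP)))


module MainArgument where

  open import Data.Nat using (ℕ; zero; suc; _+_; _*_; _^_; _≤_; _<_; z≤n; s≤s; _/_)
  import Data.Nat as N
  open import Data.Nat.Properties
  open import Data.Fin as F using (Fin; toℕ)
  import Data.Fin.Properties as FP
  open import Data.Fin.Permutation using (permutation)
  open import Data.List using (List; []; _∷_; filter)
  open import Data.List.Relation.Unary.Any using (here)
  open import Data.List.Membership.Propositional using (_∈_)
  open import Data.List.Membership.Propositional.Properties using (∈-filter⁺; ∈-filter⁻)
  open import Data.Product using (_×_; _,_; proj₁; proj₂; Σ)
  open import Data.Sum using (_⊎_; inj₁; inj₂)
  open import Data.Empty using (⊥; ⊥-elim)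
  open import Relation.Nullary using (¬_; Dec; yes; no)
  open import Relation.Binary.PropositionalEquality
  open import Function using (_∘_)
  open import Defs
  open Matchings
  open EdgeList
  open ListFacts
  open ForestBound
  open Coefficients
  open EqualityCase
  open PathStarShape
  open PathStarCounts
  open Comparison

  module ForTree (n'' a : ℕ) (a≥2 : 2 ≤ a) (T : WGraph (suc (suc (suc n''))))
    (symT : ∀ i j → T i j ≡ T j i) (loopT : ∀ i → T i i ≡ 0) (acycT : Acyclic T)
    (weights : ∀ i j → T i j ≢ 0 → T i j ≡ 1 ⊎ T i j ≡ a) (one-heavy : countWeight a T ≡ 1) where

    n : ℕ
    n = suc (suc (suc n''))
    open Counting n
    open FreeVertices n
    open InForest n T symT loopT acycT
    open InducedPaths n T symT loopT
    open Rigidity n T symT loopT acycT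

    a≢0 : a ≢ 0
    a≢0 e = <-irrefl (sym e) (≤-trans (s≤s z≤n) a≥2)

    open PendentEdge (suc n'') a a≢0 using (P; P-decomposition)

    A : ℕ
    A = a ^ 2

    A≥2 : 2 ≤ A
    A≥2 = ≤-trans a≥2 (subst (_≤ A) (*-identityʳ a) (*-monoʳ-≤ a 1≤a·1))
      where
      1≤a·1 : 1 ≤ a * 1
      1≤a·1 = ≤-trans (s≤s z≤n) (≤-trans a≥2 (≤-reflexive (sym (*-identityʳ a))))

    heavy : List Ed
    heavy = filter (λ d → T (proj₁ d) (proj₂ d) N.≟ a) E

    heavy-singleton : Σ Ed λ e → heavy ≡ e ∷ []
    heavy-singleton = length≡1⇒singleton heavy one-heavy

    e : Ed
    e = proj₁ heavy-singleton

    u v : V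
    u = proj₁ e
    v = proj₂ e

    e∈heavy : e ∈ heavy
    e∈heavy = subst (e ∈_) (sym (proj₂ heavy-singleton)) (here refl)

    e∈E : e ∈ E
    e∈E = proj₁ (∈-filter⁻ (λ d → T (proj₁ d) (proj₂ d) N.≟ a) {xs = E} e∈heavy)

    T-e : T u v ≡ a
    T-e = proj₂ (∈-filter⁻ (λ d → T (proj₁ d) (proj₂ d) N.≟ a) {xs = E} e∈heavy)

    u≢v : u ≢ v
    u≢v = ends-distinct e∈E (inj₁ (refl , refl))

    heavy-unique : ∀ {d} → d ∈ E → T (proj₁ d) (proj₂ d) ≡ a → d ≡ e
    heavy-unique {d} m ta with subst (d ∈_) (proj₂ heavy-singleton) (∈-filter⁺ (λ d → T (proj₁ d) (proj₂ d) N.≟ a) m ta)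
    ... | here eq = eq

    light-edges : ∀ {d} → d ∈ E → d ≢ e → T (proj₁ d) (proj₂ d) ≡ 1
    light-edges {d} m ne with weights (proj₁ d) (proj₂ d) (proj₂ (∈-edges⁻ T m))
    ... | inj₁ w≡1 = w≡1
    ... | inj₂ w≡a = ⊥-elim (ne (heavy-unique m w≡a))

    -- x k = m_k(T) and y k = m_k(T - u - v).
    x y : ℕ → ℕ
    x k = ν unitWeight k E []
    y k = ν unitWeight k E (cover e [])

    T-decomposition : ∀ k → b (suc k) T + y k ≡ x (suc k) + A * y k
    T-decomposition k = trans (cong (_+ y k) (AsMatchingCount.b≡ν T (suc k)))
      (heavy-edge-decomposition (AsMatchingCount.sqWeight T) k E e A uE e∈E
        (λ m ne → cong (_^ 2) (light-edges m ne)) (cong (_^ 2) T-e))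

    x-bound : ∀ k → x k ≤ pathCount n k
    x-bound = forest-bound n [] α-[]

    y-bound : ∀ k → y k ≤ pathCount (suc n'') k
    y-bound = forest-bound (suc n'') (cover e []) (suc-injective (suc-injective (sym (α-pair u≢v))))

    T⪯P : T ⪯ P
    T⪯P zero () _
    T⪯P (suc k) _ _ = decomposition-≤ (T-decomposition k) (P-decomposition k) (x-bound (suc k)) (y-bound k) (≤-trans (s≤s z≤n) A≥2)

    first-strict : ∀ K → (Σ ℕ λ j → 1 ≤ j × j ≤ K × b j T < b j P) ⊎ (∀ j → 1 ≤ j → j ≤ K → ¬ (b j T < b j P))
    first-strict zero = inj₂ λ j 1≤j j≤0 _ → <-irrefl refl (≤-trans 1≤j j≤0)
    first-strict (suc K) with b (suc K) T N.<? b (suc K) P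
    ... | yes lt = inj₁ (suc K , s≤s z≤n , ≤-refl , lt)
    ... | no nlt with first-strict K
    ...   | inj₁ (j , 1≤j , j≤K , lt) = inj₁ (j , 1≤j , ≤-trans j≤K (n≤1+n K) , lt)
    ...   | inj₂ none = inj₂ λ j 1≤j j≤K+1 → at j 1≤j j≤K+1
      where
      at : ∀ j → 1 ≤ j → j ≤ suc K → ¬ (b j T < b j P)
      at j 1≤j j≤K+1 with j N.≟ suc K
      ... | yes refl = nlt
      ... | no ne = none j 1≤j (N.s≤s⁻¹ (≤∧≢⇒< j≤K+1 ne))

    path⇒iso : ∀ ψ → InducedPath [] n ψ → Ends e (ψ F.zero) (ψ (F.suc F.zero)) → T ≅ P
    path⇒iso ψ ip ψ-heavy = permutation σ ψ (λ q → P.inj (ψσ (ψ q))) ψσ ,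
                             λ i j → trans (cong₂ T (sym (ψσ i)) (sym (ψσ j))) (T≡P-along-ψ (σ i) (σ j))
      where
      module P = InducedPath ip
      σ : Fin n → Fin n
      σ i = proj₁ (P.cov i (λ ()))
      ψσ : ∀ i → ψ (σ i) ≡ i
      ψσ i = proj₂ (P.cov i (λ ()))
      T-ends : ∀ {d f g} → Ends d f g → T (proj₁ d) (proj₂ d) ≡ T f g
      T-ends (inj₁ (e₁ , e₂)) = cong₂ T e₁ e₂
      T-ends {f = f} {g = g} (inj₂ (e₁ , e₂)) = trans (cong₂ T e₁ e₂) (symT g f)
      T-01 : T (ψ F.zero) (ψ (F.suc F.zero)) ≡ a
      T-01 = trans (sym (T-ends ψ-heavy)) T-e
      ends-e : ∀ {f g f' g'} → Ends e f g → Ends e f' g' → (f ≡ f' × g ≡ g') ⊎ (f ≡ g' × g ≡ f')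
      ends-e (inj₁ (a1 , a2)) (inj₁ (b1 , b2)) = inj₁ (trans (sym a1) b1 , trans (sym a2) b2)
      ends-e (inj₁ (a1 , a2)) (inj₂ (b1 , b2)) = inj₂ (trans (sym a1) b1 , trans (sym a2) b2)
      ends-e (inj₂ (a1 , a2)) (inj₁ (b1 , b2)) = inj₂ (trans (sym a2) b2 , trans (sym a1) b1)
      ends-e (inj₂ (a1 , a2)) (inj₂ (b1 , b2)) = inj₁ (trans (sym a2) b2 , trans (sym a1) b1)
      light-pair : ∀ q r → T (ψ q) (ψ r) ≢ 0 → ¬ HeavyPair (toℕ q) (toℕ r) → T (ψ q) (ψ r) ≡ P q r
      light-pair q r nz not-heavy with weights (ψ q) (ψ r) nz
      ... | inj₁ w≡1 = trans w≡1 (sym (trans (pathStar≡ℕ a q r) (pathStarℕ-light a _ _ (P.adj⇒ q r nz) not-heavy)))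
      ... | inj₂ w≡a = ⊥-elim (not-heavy (positions (ends-e (subst (λ z → Ends z (ψ q) (ψ r)) (heavy-unique d∈E T-d) d-ends) ψ-heavy)))
        where
        qr : Σ Ed λ d → d ∈ E × Ends d (ψ q) (ψ r)
        qr = edge-between (ψ q) (ψ r) (λ eq → nz (trans (cong (T (ψ q)) (sym eq)) (loopT (ψ q)))) nz
        d∈E : proj₁ qr ∈ E
        d∈E = proj₁ (proj₂ qr)
        d-ends : Ends (proj₁ qr) (ψ q) (ψ r)
        d-ends = proj₂ (proj₂ qr)
        T-d : T (proj₁ (proj₁ qr)) (proj₂ (proj₁ qr)) ≡ a
        T-d = trans (T-ends d-ends) w≡a
        positions : (ψ q ≡ ψ F.zero × ψ r ≡ ψ (F.suc F.zero)) ⊎ (ψ q ≡ ψ (F.suc F.zero) × ψ r ≡ ψ F.zero) → HeavyPair (toℕ q) (toℕ r)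
        positions (inj₁ (k1 , k2)) = inj₁ (cong toℕ (P.inj k1) , cong toℕ (P.inj k2))
        positions (inj₂ (k1 , k2)) = inj₂ (cong toℕ (P.inj k1) , cong toℕ (P.inj k2))
      edge-pair : ∀ q r → T (ψ q) (ψ r) ≢ 0 → Dec (HeavyPair (toℕ q) (toℕ r)) → T (ψ q) (ψ r) ≡ P q r
      edge-pair q r nz (yes (inj₁ (z1 , o2))) =
        trans (cong₂ (λ s t → T (ψ s) (ψ t)) (FP.toℕ-injective {i = q} {j = F.zero} z1) (FP.toℕ-injective {i = r} {j = F.suc F.zero} o2))
              (trans T-01 (sym (trans (pathStar≡ℕ a q r) (pathStarℕ-heavy a _ _ (inj₁ (z1 , o2))))))
      edge-pair q r nz (yes (inj₂ (o1 , z2))) =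
        trans (cong₂ (λ s t → T (ψ s) (ψ t)) (FP.toℕ-injective {i = q} {j = F.suc F.zero} o1) (FP.toℕ-injective {i = r} {j = F.zero} z2))
              (trans (symT _ _) (trans T-01 (sym (trans (pathStar≡ℕ a q r) (pathStarℕ-heavy a _ _ (inj₂ (o1 , z2)))))))
      edge-pair q r nz (no not-heavy) = light-pair q r nz not-heavy
      T≡P-along-ψ : ∀ q r → T (ψ q) (ψ r) ≡ P q r
      T≡P-along-ψ q r with T (ψ q) (ψ r) N.≟ 0
      ... | yes z = trans z (sym (trans (pathStar≡ℕ a q r) (pathStarℕ-absent a (toℕ q) (toℕ r) (λ c → P.⇒adj q r c z))))
      ... | no nz = edge-pair q r nz (HeavyPair? (toℕ q) (toℕ r))

    module Extremal (no-strict : ∀ j → 1 ≤ j → j ≤ n / 2 → ¬ (b j T < b j P)) where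

      equal-counts : ∀ k → x (suc k) ≡ pathCount n (suc k) × y k ≡ pathCount (suc n'') k
      equal-counts k with suc k N.≤? n / 2
      ... | yes le = decomposition-≡ (T-decomposition k) (P-decomposition k) (x-bound (suc k)) (y-bound k) A≥2
                       (≤-antisym (T⪯P (suc k) (s≤s z≤n) le) (≮⇒≥ (no-strict (suc k) (s≤s z≤n) le)))
      ... | no nle = vanishes (pathCount-vanishes n (suc k) n<2k) (x-bound (suc k)) ,
                     vanishes (pathCount-vanishes (suc n'') k (N.s≤s⁻¹ (N.s≤s⁻¹ n<2k))) (y-bound k)
        where
        n<2k : n < suc k * 2
        n<2k = above-half n (suc k) nle
        vanishes : ∀ {m z} → z ≡ 0 → m ≤ z → m ≡ z
        vanishes refl z≤n = refl

      x-extremal : ∀ k → x k ≡ pathCount n k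
      x-extremal zero = refl
      x-extremal (suc k) = proj₁ (equal-counts k)

      y-extremal : ∀ k → y k ≡ pathCount (suc n'') k
      y-extremal zero = refl
      y-extremal (suc k) = proj₂ (equal-counts (suc k))

      T-path : Σ (Fin n → V) (InducedPath [] n)
      T-path = equality⇒induced-path n [] α-[] x-extremal

      φ : Fin n → V
      φ = proj₁ T-path
      module Φ = InducedPath (proj₂ T-path)

      -- du = deg u, dv = number of neighbours of v other than u
      du dv : ℕ
      du = ν unitWeight 1 (incident u E) []
      dv = ν unitWeight 1 (incident v E) (u ∷ [])

      -- m_1(T) = m_1(T - u - v) + dv + du, i.e. n - 1 = (n - 3) + dv + du
      degree-sum : (n'' + dv) + du ≡ suc (suc n'')
      degree-sum = sym (begin
          suc (suc n'') ≡⟨ sym (trans (x-extremal 1) (pathCount-1 n)) ⟩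
          x 1 ≡⟨ ν1-split-at E [] u ⟩
          ν unitWeight 1 E (u ∷ []) + du ≡⟨ cong (_+ du) (ν1-split-at E (u ∷ []) v) ⟩
          (ν unitWeight 1 E (v ∷ u ∷ []) + dv) + du
            ≡⟨ cong (λ z → (z + dv) + du) (trans (ν-cong-used unitWeight 1 E swap-front) (trans (y-extremal 1) (pathCount-1 (suc n'')))) ⟩
          (n'' + dv) + du ∎)
        where open ≡-Reasoning

      IsEnd : Fin n → Set
      IsEnd q = toℕ q ≡ 0 ⊎ toℕ q ≡ suc (suc n'')

      Interior : Fin n → Set
      Interior q = Σ (Fin n) λ r₁ → Σ (Fin n) λ r₂ → Consecutive q r₁ × Consecutive q r₂ × r₁ ≢ r₂

      end-or-interior : ∀ (q : Fin n) → IsEnd q ⊎ Interior q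
      end-or-interior F.zero = inj₁ (inj₁ refl)
      end-or-interior (F.suc q') with toℕ (F.suc q') N.≟ suc (suc n'')
      ... | yes eq = inj₁ (inj₂ eq)
      ... | no ne = inj₂ (r₁ , r₂ , inj₂ (cong suc (sym (FP.toℕ-inject₁ q'))) , inj₁ to-r₂ , r₁≢r₂)
        where
        lt : toℕ (F.suc q') < suc (suc n'')
        lt = ≤∧≢⇒< (N.s≤s⁻¹ (FP.toℕ<n (F.suc q'))) ne
        r₁ r₂ : Fin n
        r₁ = F.inject₁ q'
        r₂ = F.fromℕ< (s≤s lt)
        to-r₂ : toℕ r₂ ≡ suc (toℕ (F.suc q'))
        to-r₂ = FP.toℕ-fromℕ< (s≤s lt)
        r₁≢r₂ : r₁ ≢ r₂
        r₁≢r₂ eq = <-irrefl (trans (sym (FP.toℕ-inject₁ q')) (trans (cong toℕ eq) to-r₂)) (≤-trans (n<1+n _) (n≤1+n _))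

      orient-end : ∀ {ψ} → InducedPath [] n ψ → ∀ q r {s t} → ψ q ≡ s → ψ r ≡ t → Consecutive q r → IsEnd q →
                   Σ (Fin n → V) λ ψ' → InducedPath [] n ψ' × ψ' F.zero ≡ s × ψ' (F.suc F.zero) ≡ t
      orient-end {ψ} ip q r es et c (inj₁ q≡0) =
        ψ , ip , trans (cong ψ (FP.toℕ-injective {i = F.zero} {j = q} (sym q≡0))) es , trans (cong ψ (next c)) et
        where
        next : Consecutive q r → F.suc F.zero ≡ r
        next (inj₁ e') = FP.toℕ-injective (sym (trans e' (cong suc q≡0)))
        next (inj₂ e') = ⊥-elim (0≢1+n (trans (sym q≡0) e'))
      orient-end {ψ} ip q r es et c (inj₂ q-last) =
        (ψ ∘ F.opposite) , induced-reverse ip , trans (cong ψ first) es , trans (cong ψ second) et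
        where
        first : F.opposite F.zero ≡ q
        first = FP.toℕ-injective (trans (FP.opposite-prop (F.zero {suc (suc n'')})) (sym q-last))
        r-before : Consecutive q r → toℕ r ≡ suc n''
        r-before (inj₁ e') = ⊥-elim (<-irrefl (trans e' (cong suc q-last)) (FP.toℕ<n r))
        r-before (inj₂ e') = suc-injective (trans (sym e') q-last)
        second : F.opposite (F.suc F.zero) ≡ r
        second = FP.toℕ-injective (trans (FP.opposite-prop (F.suc (F.zero {suc n''}))) (sym (r-before c)))

      pu pv : Fin n
      pu = proj₁ (Φ.cov u (λ ()))
      pv = proj₁ (Φ.cov v (λ ()))
      φ-pu : φ pu ≡ u
      φ-pu = proj₂ (Φ.cov u (λ ()))
      φ-pv : φ pv ≡ v
      φ-pv = proj₂ (Φ.cov v (λ ()))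

      pu-pv : Consecutive pu pv
      pu-pv = Φ.adj⇒ pu pv (λ z → a≢0 (trans (sym T-e) (trans (sym (cong₂ T φ-pu φ-pv)) z)))

      consecutive-distinct : ∀ {q r : Fin n} → Consecutive q r → φ q ≢ φ r
      consecutive-distinct {q} c eq with Φ.inj eq
      ... | refl = Consecutive-irrefl {p = q} c

      -- Interior u gives du ≥ 2 and interior v gives dv ≥ 1, contradicting du + dv = 2.
      not-both-interior : Interior pu → Interior pv → ⊥
      not-both-interior (r₁ , r₂ , c₁ , c₂ , r₁≢r₂) (s₁ , s₂ , c₁' , c₂' , s₁≢s₂) =
        1+n≰n (≤-trans (≤-reflexive (+-comm 3 n'')) (≤-trans (+-monoʳ-≤ n'' (+-mono-≤ dv≥1 du≥2))
               (≤-trans (≤-reflexive (sym (+-assoc n'' dv du))) (≤-reflexive degree-sum))))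
        where
        u-edge : ∀ {r} → Consecutive pu r → Σ Ed λ d → d ∈ E × Ends d u (φ r)
        u-edge {r} c = edge-between u (φ r) (λ eq → consecutive-distinct c (trans φ-pu eq))
                         (subst (λ z → Adj T z (φ r)) φ-pu (Φ.⇒adj pu r c))
        v-edge : ∀ {r} → Consecutive pv r → Σ Ed λ d → d ∈ E × Ends d v (φ r)
        v-edge {r} c = edge-between v (φ r) (λ eq → consecutive-distinct c (trans φ-pv eq))
                         (subst (λ z → Adj T z (φ r)) φ-pv (Φ.⇒adj pv r c))
        d₁ : Σ Ed λ d → d ∈ E × Ends d u (φ r₁)
        d₁ = u-edge c₁
        d₂ : Σ Ed λ d → d ∈ E × Ends d u (φ r₂)
        d₂ = u-edge c₂
        d₁≢d₂ : proj₁ d₁ ≢ proj₁ d₂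
        d₁≢d₂ eq = r₁≢r₂ (Φ.inj (ends-same (subst (λ z → Ends z u (φ r₁)) eq (proj₂ (proj₂ d₁))) (proj₂ (proj₂ d₂))))
        du≥2 : 2 ≤ du
        du≥2 = ν1-≥2 (incident u E) [] (incident-unique u uE)
                 (incident-∈ (proj₁ (proj₂ d₁)) (ends-touch (proj₂ (proj₂ d₁))))
                 (incident-∈ (proj₁ (proj₂ d₂)) (ends-touch (proj₂ (proj₂ d₂)))) d₁≢d₂ ((λ ()) , (λ ())) ((λ ()) , (λ ()))
        other : Dec (φ s₁ ≡ u) → Σ (Fin n) λ s → Consecutive pv s × φ s ≢ u
        other (no ne) = s₁ , c₁' , ne
        other (yes eq) = s₂ , c₂' , λ eq₂ → s₁≢s₂ (Φ.inj (trans eq (sym eq₂)))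
        s : Σ (Fin n) λ s → Consecutive pv s × φ s ≢ u
        s = other (φ s₁ F.≟ u)
        dv-edge : Σ Ed λ d → d ∈ E × Ends d v (φ (proj₁ s))
        dv-edge = v-edge (proj₁ (proj₂ s))
        dv≥1 : 1 ≤ dv
        dv≥1 = ν1-≥1 (incident v E) (u ∷ []) (incident-unique v uE)
                 (incident-∈ (proj₁ (proj₂ dv-edge)) (ends-touch (proj₂ (proj₂ dv-edge))))
                 (ends-avoid⁺ (proj₂ (proj₂ dv-edge)) (∉-∷ (≢-sym u≢v) (λ ())) (∉-∷ (proj₂ (proj₂ s)) (λ ())))

      oriented : Σ (Fin n → V) λ ψ → InducedPath [] n ψ × Ends e (ψ F.zero) (ψ (F.suc F.zero))
      oriented with end-or-interior pu | end-or-interior pv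
      ... | inj₁ u-end | _ = let (ψ , ip , at-0 , at-1) = orient-end (proj₂ T-path) pu pv φ-pu φ-pv pu-pv u-end
                             in ψ , ip , inj₁ (sym at-0 , sym at-1)
      ... | inj₂ _ | inj₁ v-end = let (ψ , ip , at-0 , at-1) = orient-end (proj₂ T-path) pv pu φ-pv φ-pu (Consecutive-sym pu-pv) v-end
                                  in ψ , ip , inj₂ (sym at-1 , sym at-0)
      ... | inj₂ u-int | inj₂ v-int = ⊥-elim (not-both-interior u-int v-int)

    tree-vs-pathStar : ¬ (T ≅ P) → T ≺ P
    tree-vs-pathStar T≇P with first-strict (n / 2)
    ... | inj₁ (j , 1≤j , j≤n/2 , lt) = T⪯P , j , 1≤j , j≤n/2 , lt
    ... | inj₂ none = ⊥-elim (T≇P (path⇒iso ψ ip ends))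
      where
      open Extremal none
      ψ : Fin n → V
      ψ = proj₁ oriented
      ip : InducedPath [] n ψ
      ip = proj₁ (proj₂ oriented)
      ends : Ends e (ψ F.zero) (ψ (F.suc F.zero))
      ends = proj₂ (proj₂ oriented)


open import Data.Nat using (suc; s≤s)
open import Data.Nat.Properties using (m≤n+m)
open import Data.Product using (_,_)

theorem7 : (n m : ℕ) → 3 ≤ n → n ≤ m →
    (T : WGraph n) → InTreeClass n (m ∸ n + 2) T →
    ¬ (T ≅ pathStar n (m ∸ n + 2)) →
    T ≺ pathStar n (m ∸ n + 2)
theorem7 n@(suc (suc (suc n''))) m (s≤s (s≤s (s≤s _))) _ T (((symT , loopT) , _ , acyclic) , weights , one-heavy) =
  MainArgument.ForTree.tree-vs-pathStar n'' (m ∸ n + 2) (m≤n+m 2 (m ∸ n)) T symT loopT acyclic weights one-heavy
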